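{- For every positive integer $\Delta$ there is $\alpha_0>0$ such that for every $\alpha\in(0,\alpha_0]$ there is $n_0$ such that for all $n\geq n_0$ the following holds. Let $G$ be an abelian group of order $n$ and $T$ a tree with $\Delta(T)=\Delta$. Let $V_{target},C_{target}\subseteq G$ with $|V(T)|=|V_{target}|=|C_{target}|+1\geq(1-n^{ -\alpha})n$; in the case $G\cong\mathbb{Z}_2^m$ assume $0\notin C_{target}$. Let $T_{core}$ be a core of $T$ with at most $n^{1-\alpha}$ vertices. Then every rainbow embedding $\phi$ of $T_{core}$ into $(V_{target},C_{target})$ with $\sum_{v\in V(T_{core})}d_T(v)\phi(v)=\sum_{c\in C_{target}}c$ and $\sum_{v\in V(T_{core})}\phi(v)=\sum_{x\in V_{target}}x$ extends to a pseudoembedding $h$ of $T$ into $(V_{target},C_{target})$.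
   Context: $K_G$ is the complete graph on $G$ with edge $xy$ coloured $x+y$. A rainbow embedding of a forest $F$ into $(V_{target},C_{target})$ is an injection $f:V(F)\to G$ with $f(V(F))\subseteq V_{target}$ such that the colours $f(x)+f(y)$, $xy\in E(F)$, are pairwise distinct and lie in $C_{target}$. A pseudoembedding of $T$ into $(V_{target},C_{target})$ is an injection $h:V(T)\to G$ whose image is exactly $V_{target}$ and with $\sum_{v\in V(T)}d_T(v)h(v)=\sum_{c\in C_{target}}c$. A core of $T$ is an induced subforest $T_{core}$ such that for every $d\leq\Delta(T)$ either (I) $T_{core}$ contains all vertices of $T$-degree $d$, or (II) both $T_{core}$ and $T\setminus V(T_{core})$ contain at least $6$ vertices of $T$-degree $d$. -}

module Defs where

open import Data.Nat using (ℕ; zero; suc; _+_; _≤_; _≡ᵇ_)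
open import Data.Bool using (Bool; true; false; if_then_else_; _∧_; not; _xor_)
open import Data.Fin using (Fin; zero; suc)
open import Data.Vec using (Vec; zipWith)
open import Data.List using (List; []; _∷_; length; _∷ʳ_)
open import Data.List.Relation.Unary.Linked using (Linked)
open import Data.List.Relation.Unary.Unique.Propositional using (Unique)
open import Data.Product using (Σ; ∃; _×_; _,_)
open import Data.Sum using (_⊎_)
open import Relation.Nullary using (¬_)
open import Relation.Binary.PropositionalEquality using (_≡_)
open import Algebra.Structures using (IsAbelianGroup)

count : ∀ {k} → (Fin k → Bool) → ℕ
count {zero}  P = 0
count {suc k} P = (if P zero then 1 else 0) + count (λ i → P (suc i))

-- A finite abelian group of order n, with carrier Fin n (every abelian group
-- of order n is isomorphic to one of this form).
record FinAbGroup (n : ℕ) : Set where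
  field
    _⊕_ : Fin n → Fin n → Fin n
    0g  : Fin n
    ⊖_  : Fin n → Fin n
    isAbelianGroup : IsAbelianGroup _≡_ _⊕_ 0g ⊖_

module _ {n : ℕ} (G : FinAbGroup n) where
  open FinAbGroup G

  gsum : ∀ {k} → (Fin k → Fin n) → Fin n
  gsum {zero}  f = 0g
  gsum {suc k} f = f zero ⊕ gsum (λ i → f (suc i))

  nmul : ℕ → Fin n → Fin n
  nmul zero    g = 0g
  nmul (suc d) g = g ⊕ nmul d g

  setSum : (Fin n → Bool) → Fin n
  setSum X = gsum (λ x → if X x then x else 0g)

  IsZ2Power : Set
  IsZ2Power = Σ ℕ λ m → Σ (Fin n → Vec Bool m) λ f →
      (∀ x y → f x ≡ f y → x ≡ y)
    × (∀ v → ∃ λ x → f x ≡ v)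
    × (∀ x y → f (x ⊕ y) ≡ zipWith _xor_ (f x) (f y))

data Walk {N : ℕ} (A : Fin N → Fin N → Bool) : Fin N → Fin N → Set where
  here : ∀ {u} → Walk A u u
  step : ∀ {u v w} → A u v ≡ true → Walk A v w → Walk A u w

IsCycle : ∀ {N} → (Fin N → Fin N → Bool) → Fin N → List (Fin N) → Set
IsCycle A v vs = 3 ≤ length (v ∷ vs) × Unique (v ∷ vs)
               × Linked (λ a b → A a b ≡ true) ((v ∷ vs) ∷ʳ v)

record Tree (N : ℕ) : Set where
  field
    adj       : Fin N → Fin N → Bool
    adj-sym   : ∀ u v → adj u v ≡ adj v u
    adj-irr   : ∀ u → adj u u ≡ false
    connected : ∀ u v → Walk adj u v
    acyclic   : ∀ v vs → ¬ IsCycle adj v vs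

module _ {N : ℕ} (T : Tree N) where
  open Tree T

  deg : Fin N → ℕ
  deg v = count (adj v)

  MaxDeg : ℕ → Set
  MaxDeg Δ = (∀ v → deg v ≤ Δ) × ∃ λ v → deg v ≡ Δ

  -- S (a vertex subset, inducing T_core) is a core of T, where Δ = Δ(T)
  IsCore : ℕ → (Fin N → Bool) → Set
  IsCore Δ S = ∀ d → d ≤ Δ →
      (∀ v → deg v ≡ d → S v ≡ true)
    ⊎ (6 ≤ count (λ v → S v ∧ (deg v ≡ᵇ d))
       × 6 ≤ count (λ v → not (S v) ∧ (deg v ≡ᵇ d)))

  module _ {n : ℕ} (G : FinAbGroup n) where
    open FinAbGroup G

    RainbowOn : (Fin N → Bool) → (Fin n → Bool) → (Fin n → Bool) → (Fin N → Fin n) → Set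
    RainbowOn S V C φ =
        (∀ u v → S u ≡ true → S v ≡ true → φ u ≡ φ v → u ≡ v)
      × (∀ v → S v ≡ true → V (φ v) ≡ true)
      × (∀ x y → S x ≡ true → S y ≡ true → adj x y ≡ true → C (φ x ⊕ φ y) ≡ true)
      × (∀ x y x' y' → S x ≡ true → S y ≡ true → S x' ≡ true → S y' ≡ true
           → adj x y ≡ true → adj x' y' ≡ true → φ x ⊕ φ y ≡ φ x' ⊕ φ y'
           → (x ≡ x' × y ≡ y') ⊎ (x ≡ y' × y ≡ x'))

    Pseudo : (Fin n → Bool) → (Fin n → Bool) → (Fin N → Fin n) → Set
    Pseudo V C h =
        (∀ u v → h u ≡ h v → u ≡ v)
      × (∀ g → V g ≡ true → ∃ λ v → h v ≡ g)
      × (∀ v → V (h v) ≡ true)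
      × gsum G (λ v → nmul G (deg v) (h v)) ≡ setSum G C

if-in : ∀ {N n} → (Fin N → Bool) → Fin N → Fin n → FinAbGroup n → Fin n
if-in S v x G = if S v then x else FinAbGroup.0g G

-- Outside the core, group the vertices of T into layers by degree. The targets not used by φ
-- form a set R containing almost all of G, and R sums to 0 because φ(core) already sums to ΣV.
-- If R is split into parts, one per layer and of the layer's size, each summing to 0, then any
-- bijection of each layer onto its part adds Σ_d d · 0 = 0 to the weighted sum, which φ already
-- makes ΣC. A largest layer takes what is left over, which sums to 0 as well, so only the other
-- layers need zero-sum parts; by the core condition their sizes are 0 or at least 6, hence sums
-- of at most three 3's and some 4's. Zero-sum triples {x, y, -(x + y)} are found one at a time
-- by counting in the dense set R. Zero-sum quadruples are {x, σx, y, σy}, where σ pairs each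
-- element with its negative or, for elements of order at most 2, with its translate by a fixed
-- element a of order 2: pair sums are 0 or a, and two pairs of the same kind cancel. Counting
-- shows that these cover enough of R once R misses only a small fraction of G, which is where
-- α enters.
module Submission where

open import Defs
open import Data.Nat using (ℕ; suc; _*_; _∸_; _^_; _≤_; _<_)
open import Data.Bool using (Bool; true; false)
open import Data.Fin using (Fin)
open import Data.Product using (∃; _×_)
open import Relation.Binary.PropositionalEquality using (_≡_)

open import Algebra.Bundles using (AbelianGroup; CommutativeMonoid)
import Algebra.Properties.AbelianGroup as AbelianGroupProperties
import Algebra.Properties.CommutativeSemigroup as CommutativeSemigroupProperties
open import Data.Bool as Bool using (if_then_else_; not; _∧_; _∨_)
open import Data.Bool.Properties using (T-≡)
open import Data.Empty using (⊥; ⊥-elim)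
open import Data.Fin as Fin using (zero; suc)
import Data.Fin.Properties as Fin
open import Data.List using (List; []; _∷_; _++_; length; map; filter; zipWith; zip; allFin; tabulate; concat; foldr; upTo)
open import Data.List.Extrema.Nat using (argmax; f[xs]≤f[argmax])
open import Data.List.Membership.Propositional using (_∈_)
open import Data.List.Membership.Propositional.Properties
  using (∈-filter⁺; ∈-filter⁻; ∈-allFin; ∈-map⁺; ∈-map⁻; ∈-++⁺ˡ; ∈-++⁺ʳ; ∈-++⁻; ∈-upTo⁺;
         ∈-upTo⁻)
open import Data.List.Membership.Propositional.Properties.WithK using (unique∧set⇒bag)
import Data.List.Membership.DecPropositional as DecMembership
open import Data.List.Properties
  using (length-++; length-map; length-tabulate; length-filter; length-upTo; map-tabulate; map-id; map-++;
         ++-assoc; concat-++; map-cong-local; ∷-injective)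
open import Data.List.Relation.Binary.BagAndSetEquality using (∼bag⇒↭)
open import Data.List.Relation.Binary.Permutation.Propositional
  using (↭⇒↭ₛ; _↭_; ↭-refl; ↭-trans; ↭-sym; ↭-reflexive)
import Data.List.Relation.Binary.Permutation.Propositional.Properties as Permutation
open Permutation using (↭-length; ++⁺ˡ; ++⁺ʳ; ++-commutativeMonoid; ++-comm; ∈-resp-↭)
import Data.List.Relation.Binary.Permutation.Setoid.Properties as Permutationₛ
open import Data.List.Relation.Binary.Pointwise using (Pointwise; []; _∷_)
open import Data.List.Relation.Unary.All as All using (All; []; _∷_)
import Data.List.Relation.Unary.All.Properties as All
open import Data.List.Relation.Unary.AllPairs using ([]; _∷_)
open import Data.List.Relation.Unary.Any using (here; there)
open import Data.List.Relation.Unary.Unique.Propositional using (Unique)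
import Data.List.Relation.Unary.Unique.Propositional.Properties as Unique
open import Data.Nat as ℕ using (zero; _+_; z≤n; s≤s)
open import Data.Nat.ListAction using (sum)
open import Data.Nat.Properties
open import Data.Nat.Tactic.RingSolver using (solve-∀)
open import Data.Product as Product using (Σ; _,_; proj₁; proj₂; ∃₂)
open import Data.Sum using (_⊎_; inj₁; inj₂)
open import Function using (_∘_; id; _⇔_; mk⇔; Equivalence)
open import Level using (0ℓ)
open import Relation.Binary.Definitions using (DecidableEquality)
open import Relation.Binary.PropositionalEquality
  using (setoid; _≢_; refl; sym; trans; cong; cong₂; subst; module ≡-Reasoning)
open import Relation.Nullary using (¬_; ¬?; Dec; yes; no; does; contradiction; _×-dec_)
open import Relation.Nullary.Decidable using (dec-true; dec-false; decidable-stable)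

private
  variable
    A B C : Set
    k : ℕ

not-true : ∀ {b} → not b ≡ true → b ≡ false
not-true {false} _ = refl

∧-true : ∀ {a b} → a ∧ b ≡ true → a ≡ true × b ≡ true
∧-true {true} {true} _ = refl , refl

∨-false : ∀ {a b} → a ∨ b ≡ false → a ≡ false × b ≡ false
∨-false {false} {false} _ = refl , refl

does-true : {P : Set} (p? : Dec P) → does p? ≡ true → P
does-true (yes p) _ = p

module _ {A : Set} where

  ↭-of-same-elements : {xs ys : List A} → Unique xs → Unique ys → (∀ {x} → x ∈ xs ⇔ x ∈ ys) → xs ↭ ys
  ↭-of-same-elements xs! ys! same = ∼bag⇒↭ (unique∧set⇒bag xs! ys! same)

  Unique∧constant⇒length≤1 : ∀ {xs : List A} {c} → Unique xs → (∀ {x} → x ∈ xs → x ≡ c) → length xs ≤ 1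
  Unique∧constant⇒length≤1 {[]} _ _ = z≤n
  Unique∧constant⇒length≤1 {_ ∷ []} _ _ = s≤s z≤n
  Unique∧constant⇒length≤1 {_ ∷ _ ∷ _} ((x≢y ∷ _) ∷ _) constant =
    ⊥-elim (x≢y (trans (constant (here refl)) (sym (constant (there (here refl))))))

  Unique-resp-↭ : ∀ {xs ys : List A} → xs ↭ ys → Unique xs → Unique ys
  Unique-resp-↭ p = Permutationₛ.Unique-resp-↭ (setoid A) (↭⇒↭ₛ p)

  Unique-++⁻ʳ : ∀ xs {ys : List A} → Unique (xs ++ ys) → Unique ys
  Unique-++⁻ʳ [] ys! = ys!
  Unique-++⁻ʳ (_ ∷ xs) (_ ∷ xs++ys!) = Unique-++⁻ʳ xs xs++ys!

  Unique-map⁺-injectiveOn : ∀ {f : A → B} {xs} → (∀ {x y} → x ∈ xs → y ∈ xs → f x ≡ f y → x ≡ y) →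
                            Unique xs → Unique (map f xs)
  Unique-map⁺-injectiveOn {xs = []} _ [] = []
  Unique-map⁺-injectiveOn {xs = x ∷ xs} injective (x∉xs ∷ xs!) =
    All.map⁺ (All.tabulate λ y∈xs fx≡fy → All.lookup x∉xs y∈xs (injective (here refl) (there y∈xs) fx≡fy))
    ∷ Unique-map⁺-injectiveOn (λ x∈ y∈ → injective (there x∈) (there y∈)) xs!

  Unique-map⇒injectiveOn : ∀ {f : A → B} {xs x y} → Unique (map f xs) → x ∈ xs → y ∈ xs → f x ≡ f y → x ≡ y
  Unique-map⇒injectiveOn _ (here refl) (here refl) _ = refl
  Unique-map⇒injectiveOn (fx∉ ∷ _) (here refl) (there y∈) e = ⊥-elim (All.lookup fx∉ (∈-map⁺ _ y∈) e)
  Unique-map⇒injectiveOn (fy∉ ∷ _) (there x∈) (here refl) e = ⊥-elim (All.lookup fy∉ (∈-map⁺ _ x∈) (sym e))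
  Unique-map⇒injectiveOn (_ ∷ fxs!) (there x∈) (there y∈) e = Unique-map⇒injectiveOn fxs! x∈ y∈ e

  map-cong-local⁻ : ∀ {f g : A → B} {xs x} → map f xs ≡ map g xs → x ∈ xs → f x ≡ g x
  map-cong-local⁻ {xs = _ ∷ _} e (here refl) = proj₁ (∷-injective e)
  map-cong-local⁻ {xs = _ ∷ _} e (there x∈) = map-cong-local⁻ (proj₂ (∷-injective e)) x∈

  ++-injectiveˡ : ∀ {xs ys zs ws : List A} → length xs ≡ length ys → xs ++ zs ≡ ys ++ ws → xs ≡ ys
  ++-injectiveˡ {[]} {[]} _ _ = refl
  ++-injectiveˡ {_ ∷ _} {_ ∷ _} len e =
    cong₂ _∷_ (proj₁ (∷-injective e)) (++-injectiveˡ (suc-injective len) (proj₂ (∷-injective e)))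

  split-by-length : ∀ (xs : List A) m {l} → length xs ≡ m + l →
                    ∃₂ λ ys zs → xs ≡ ys ++ zs × length ys ≡ m × length zs ≡ l
  split-by-length xs zero len = [] , xs , refl , refl , len
  split-by-length (x ∷ xs) (suc m) len with split-by-length xs m (suc-injective len)
  ... | ys , zs , refl , ys-len , zs-len = x ∷ ys , zs , refl , cong suc ys-len , zs-len

  zipWith-++ : ∀ (f : A → B → C) {as bs cs ds} → length as ≡ length cs →
               zipWith f (as ++ bs) (cs ++ ds) ≡ zipWith f as cs ++ zipWith f bs ds
  zipWith-++ f {[]} {cs = []} _ = refl
  zipWith-++ f {a ∷ as} {bs} {c ∷ cs} {ds} len = cong (f a c ∷_) (zipWith-++ f {as} {bs} {cs} {ds} (suc-injective len))

  zipWith-map : ∀ (f : A → B → C) (g : A → B) xs → zipWith f xs (map g xs) ≡ map (λ x → f x (g x)) xs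
  zipWith-map f g [] = refl
  zipWith-map f g (x ∷ xs) = cong (f x (g x) ∷_) (zipWith-map f g xs)

module Removal {A : Set} (_≟_ : DecidableEquality A) where
  open import Data.List.Membership.DecPropositional _≟_ using (_∈?_; _∉?_)

  opaque
    _∖_ : List A → List A → List A
    xs ∖ ys = filter (_∉? ys) xs

    ∈-∖⁺ : ∀ {x xs ys} → x ∈ xs → ¬ x ∈ ys → x ∈ xs ∖ ys
    ∈-∖⁺ {ys = ys} = ∈-filter⁺ (_∉? ys)

    ∈-∖⁻ : ∀ {x xs ys} → x ∈ xs ∖ ys → x ∈ xs × ¬ x ∈ ys
    ∈-∖⁻ {xs = xs} {ys} = ∈-filter⁻ (_∉? ys) {xs = xs}

    Unique-∖ : ∀ {xs} ys → Unique xs → Unique (xs ∖ ys)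
    Unique-∖ {xs} ys = Unique.filter⁺ (_∉? ys) {xs}

  ↭-++-∖ : ∀ {xs ys} → Unique xs → Unique ys → (∀ {y} → y ∈ ys → y ∈ xs) → xs ↭ ys ++ xs ∖ ys
  ↭-++-∖ {xs} {ys} xs! ys! ys⊆xs = ↭-of-same-elements xs! (Unique.++⁺ ys! (Unique-∖ ys xs!) disjoint) (mk⇔ to from)
    where
    disjoint : ∀ {x} → x ∈ ys × x ∈ xs ∖ ys → ⊥
    disjoint (x∈ys , x∈rest) = proj₂ (∈-∖⁻ {xs = xs} x∈rest) x∈ys
    to : ∀ {x} → x ∈ xs → x ∈ ys ++ xs ∖ ys
    to {x} x∈xs with x ∈? ys
    ... | yes x∈ys = ∈-++⁺ˡ x∈ys
    ... | no x∉ys = ∈-++⁺ʳ ys (∈-∖⁺ x∈xs x∉ys)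
    from : ∀ {x} → x ∈ ys ++ xs ∖ ys → x ∈ xs
    from x∈ with ∈-++⁻ ys x∈
    ... | inj₁ x∈ys = ys⊆xs x∈ys
    ... | inj₂ x∈rest = proj₁ (∈-∖⁻ {xs = xs} x∈rest)

-- Counting subsets of Fin k

count-tabulate : ∀ (p : A → Bool) (f : Fin k → A) →
                 count (p ∘ f) ≡ length (filter (λ a → p a Bool.≟ true) (tabulate f))
count-tabulate {k = zero} p f = refl
count-tabulate {k = suc k} p f with p (f zero)
... | true = cong suc (count-tabulate p (f ∘ suc))
... | false = count-tabulate p (f ∘ suc)

opaque
  enum : (Fin k → Bool) → List (Fin k)
  enum P = filter (λ i → P i Bool.≟ true) (allFin _)

  ∈-enum⁺ : ∀ {P : Fin k → Bool} {i} → P i ≡ true → i ∈ enum P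
  ∈-enum⁺ {P = P} {i} = ∈-filter⁺ (λ j → P j Bool.≟ true) (∈-allFin i)

  ∈-enum⁻ : ∀ {P : Fin k → Bool} {i} → i ∈ enum P → P i ≡ true
  ∈-enum⁻ {P = P} i∈ = proj₂ (∈-filter⁻ (λ j → P j Bool.≟ true) {xs = allFin _} i∈)

  Unique-enum : ∀ {P : Fin k → Bool} → Unique (enum P)
  Unique-enum {P = P} = Unique.filter⁺ (λ j → P j Bool.≟ true) (Unique.allFin⁺ _)

  length-enum : ∀ (P : Fin k → Bool) → length (enum P) ≡ count P
  length-enum P = sym (count-tabulate P id)

  _∈ᵇ_ : Fin k → List (Fin k) → Bool
  i ∈ᵇ xs = does (DecMembership._∈?_ Fin._≟_ i xs)

  ∈ᵇ⇒∈ : ∀ {i : Fin k} {xs} → i ∈ᵇ xs ≡ true → i ∈ xs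
  ∈ᵇ⇒∈ {i = i} {xs} = does-true (DecMembership._∈?_ Fin._≟_ i xs)

  ∈⇒∈ᵇ : ∀ {i : Fin k} {xs} → i ∈ xs → i ∈ᵇ xs ≡ true
  ∈⇒∈ᵇ {i = i} {xs} = dec-true (DecMembership._∈?_ Fin._≟_ i xs)

count≡length : ∀ {P : Fin k → Bool} {xs} → Unique xs → (∀ {i} → i ∈ xs ⇔ P i ≡ true) → count P ≡ length xs
count≡length {P = P} xs! members = trans (sym (length-enum P))
  (↭-length (↭-of-same-elements Unique-enum xs!
    (mk⇔ (Equivalence.from members ∘ ∈-enum⁻) (∈-enum⁺ ∘ Equivalence.to members))))

count-∈ᵇ : ∀ {xs : List (Fin k)} → Unique xs → count (_∈ᵇ xs) ≡ length xs
count-∈ᵇ xs! = count≡length xs! (mk⇔ ∈⇒∈ᵇ ∈ᵇ⇒∈)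

count≤ : ∀ (P : Fin k → Bool) → count P ≤ k
count≤ {zero} P = z≤n
count≤ {suc k} P with P zero
... | true = s≤s (count≤ (P ∘ suc))
... | false = m≤n⇒m≤1+n (count≤ (P ∘ suc))

count-none : ∀ {P : Fin k → Bool} → (∀ i → P i ≡ false) → count P ≡ 0
count-none {zero} _ = refl
count-none {suc k} {P} none rewrite none zero = count-none (none ∘ suc)

count≤1 : ∀ {P : Fin k → Bool} j → (∀ i → P i ≡ true → i ≡ j) → count P ≤ 1
count≤1 {P = P} j only-j = subst (_≤ 1) (length-enum P) (Unique∧constant⇒length≤1 Unique-enum (only-j _ ∘ ∈-enum⁻))

count-∧-∨ : ∀ (P Q : Fin k → Bool) → count (λ i → P i ∧ Q i) + count (λ i → P i ∨ Q i) ≡ count P + count Q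
count-∧-∨ {zero} P Q = refl
count-∧-∨ {suc k} P Q with P zero | Q zero | count-∧-∨ (P ∘ suc) (Q ∘ suc)
... | true | true | ih = cong suc (trans (+-suc _ _) (trans (cong suc ih) (sym (+-suc _ _))))
... | true | false | ih = trans (+-suc _ _) (cong suc ih)
... | false | true | ih = trans (+-suc _ _) (trans (cong suc ih) (sym (+-suc _ _)))
... | false | false | ih = ih

count-∨≤ : ∀ (P Q : Fin k → Bool) → count (λ i → P i ∨ Q i) ≤ count P + count Q
count-∨≤ P Q = subst (count (λ i → P i ∨ Q i) ≤_) (count-∧-∨ P Q) (m≤n+m _ _)

count-∧≥ : ∀ (P Q : Fin k → Bool) → count P + count Q ≤ count (λ i → P i ∧ Q i) + k
count-∧≥ {k} P Q = subst (_≤ count (λ i → P i ∧ Q i) + k) (count-∧-∨ P Q)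
                         (+-monoʳ-≤ (count (λ i → P i ∧ Q i)) (count≤ (λ i → P i ∨ Q i)))

count-∧-not : ∀ (P Q : Fin k → Bool) → count (λ i → P i ∧ Q i) + count (λ i → P i ∧ not (Q i)) ≡ count P
count-∧-not {zero} P Q = refl
count-∧-not {suc k} P Q with P zero | Q zero | count-∧-not (P ∘ suc) (Q ∘ suc)
... | true | true | ih = cong suc ih
... | true | false | ih = trans (+-suc _ _) (cong suc ih)
... | false | _ | ih = ih

count-∘-bijection : ∀ (P : Fin k → Bool) (π π⁻¹ : Fin k → Fin k) →
                    (∀ i → π (π⁻¹ i) ≡ i) → (∀ i → π⁻¹ (π i) ≡ i) → count (P ∘ π) ≡ count P
count-∘-bijection P π π⁻¹ right left = begin
  count (P ∘ π)                   ≡⟨ sym (length-enum (P ∘ π)) ⟩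
  length (enum (P ∘ π))           ≡⟨ sym (length-map π (enum (P ∘ π))) ⟩
  length (map π (enum (P ∘ π)))   ≡⟨ sym (count≡length image! (mk⇔ to from)) ⟩
  count P                         ∎
  where
  open ≡-Reasoning
  image! : Unique (map π (enum (P ∘ π)))
  image! = Unique.map⁺ (λ {i} {j} e → trans (sym (left i)) (trans (cong π⁻¹ e) (left j))) Unique-enum
  to : ∀ {i} → i ∈ map π (enum (P ∘ π)) → P i ≡ true
  to i∈ with ∈-map⁻ π i∈
  ... | j , j∈ , refl = ∈-enum⁻ j∈
  from : ∀ {i} → P i ≡ true → i ∈ map π (enum (P ∘ π))
  from {i} Pi = subst (_∈ _) (right i) (∈-map⁺ π (∈-enum⁺ (subst (λ j → P j ≡ true) (sym (right i)) Pi)))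

∃-avoiding : ∀ (P B : Fin k → Bool) → count B < count P → ∃ λ i → P i ≡ true × B i ≡ false
∃-avoiding {suc k} P B lt with P zero in p₀ | B zero in b₀
... | true | false = zero , p₀ , b₀
... | true | true = Product.map suc id (∃-avoiding (P ∘ suc) (B ∘ suc) (ℕ.s<s⁻¹ lt))
... | false | true = Product.map suc id (∃-avoiding (P ∘ suc) (B ∘ suc) (<-trans (n<1+n _) lt))
... | false | false = Product.map suc id (∃-avoiding (P ∘ suc) (B ∘ suc) lt)

∃-member : ∀ (P : Fin k → Bool) → 0 < count P → ∃ λ i → P i ≡ true
∃-member {k} P pos =
  Product.map₂ proj₁ (∃-avoiding P (λ _ → false) (subst (_< count P) (sym (count-none {k} (λ _ → refl))) pos))

-- Sums in a finite abelian group

module GroupSums {n : ℕ} (G : FinAbGroup n) where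
  open FinAbGroup G public

  abelianGroup : AbelianGroup 0ℓ 0ℓ
  abelianGroup = record { isAbelianGroup = isAbelianGroup }

  open AbelianGroup abelianGroup public
    using (assoc; comm; identityˡ; identityʳ; inverseˡ; inverseʳ; isCommutativeMonoid; commutativeSemigroup)
  open AbelianGroupProperties abelianGroup public
    using (⁻¹-∙-comm; ⁻¹-involutive; ⁻¹-injective; identityʳ-unique; inverseʳ-unique; ε⁻¹≈ε)
  open CommutativeSemigroupProperties commutativeSemigroup public using (interchange)

  lsum : List (Fin n) → Fin n
  lsum = foldr _⊕_ 0g

  lsum-++ : ∀ xs ys → lsum (xs ++ ys) ≡ lsum xs ⊕ lsum ys
  lsum-++ [] ys = sym (identityˡ _)
  lsum-++ (x ∷ xs) ys = trans (cong (x ⊕_) (lsum-++ xs ys)) (sym (assoc x _ _))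

  lsum-↭ : ∀ {xs ys} → xs ↭ ys → lsum xs ≡ lsum ys
  lsum-↭ p = Permutationₛ.foldr-commMonoid (setoid (Fin n)) isCommutativeMonoid (↭⇒↭ₛ p)

  gsum-as-lsum : ∀ (f : Fin k → Fin n) → gsum G f ≡ lsum (map f (allFin k))
  gsum-as-lsum {zero} f = refl
  gsum-as-lsum {suc k} f = cong (f zero ⊕_) (begin
    gsum G (f ∘ suc)                    ≡⟨ gsum-as-lsum (f ∘ suc) ⟩
    lsum (map (f ∘ suc) (allFin k))     ≡⟨ cong lsum (map-tabulate id (f ∘ suc)) ⟩
    lsum (tabulate (f ∘ suc))           ≡⟨ cong lsum (sym (map-tabulate suc f)) ⟩
    lsum (map f (tabulate suc))         ∎)
    where open ≡-Reasoning

  lsum-if : ∀ (P : A → Bool) (f : A → Fin n) xs →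
            lsum (map (λ a → if P a then f a else 0g) xs) ≡ lsum (map f (filter (λ a → P a Bool.≟ true) xs))
  lsum-if P f [] = refl
  lsum-if P f (a ∷ xs) with P a
  ... | true = cong (f a ⊕_) (lsum-if P f xs)
  ... | false = trans (identityˡ _) (lsum-if P f xs)

  opaque
    unfolding enum
    gsum-if : ∀ (P : Fin k → Bool) (f : Fin k → Fin n) →
              gsum G (λ i → if P i then f i else 0g) ≡ lsum (map f (enum P))
    gsum-if P f = trans (gsum-as-lsum (λ i → if P i then f i else 0g)) (lsum-if P f (allFin _))

  setSum-as-lsum : ∀ (X : Fin n → Bool) → setSum G X ≡ lsum (enum X)
  setSum-as-lsum X = trans (gsum-if X id) (cong lsum (map-id (enum X)))

  nmul-0g : ∀ d → nmul G d 0g ≡ 0g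
  nmul-0g zero = refl
  nmul-0g (suc d) = trans (identityˡ _) (nmul-0g d)

  nmul-⊕ : ∀ d x y → nmul G d (x ⊕ y) ≡ nmul G d x ⊕ nmul G d y
  nmul-⊕ zero x y = sym (identityˡ 0g)
  nmul-⊕ (suc d) x y = trans (cong ((x ⊕ y) ⊕_) (nmul-⊕ d x y)) (interchange x y _ _)

  lsum-nmul : ∀ d xs → lsum (map (nmul G d) xs) ≡ nmul G d (lsum xs)
  lsum-nmul d [] = sym (nmul-0g d)
  lsum-nmul d (x ∷ xs) = trans (cong (nmul G d x ⊕_) (lsum-nmul d xs)) (sym (nmul-⊕ d x _))

  infix 5 _==_
  _==_ : Fin n → Fin n → Bool
  x == y = does (x Fin.≟ y)

  ==⇒≡ : ∀ {x y} → x == y ≡ true → x ≡ y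
  ==⇒≡ = does-true (_ Fin.≟ _)

  ==⇒≢ : ∀ {x y} → x == y ≡ false → x ≢ y
  ==⇒≢ {x} e refl = contradiction (trans (sym e) (dec-true (x Fin.≟ x) refl)) λ ()

  double-translation : ∀ {y g c} → y ⊕ y ≡ c → (y ⊕ g) ⊕ (y ⊕ g) ≡ c → g ⊕ g ≡ 0g
  double-translation {y} {g} {c} 2y≡c 2[y+g]≡c = identityʳ-unique c (g ⊕ g) (begin
    c ⊕ (g ⊕ g)               ≡⟨ cong (_⊕ (g ⊕ g)) (sym 2y≡c) ⟩
    (y ⊕ y) ⊕ (g ⊕ g)         ≡⟨ interchange y y g g ⟩
    (y ⊕ g) ⊕ (y ⊕ g)         ≡⟨ 2[y+g]≡c ⟩
    c                         ∎)
    where open ≡-Reasoning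

-- Extracting disjoint zero-sum blocks

module ZeroSumBlocks {n : ℕ} (G : FinAbGroup n) where
  open GroupSums G
  open Removal (Fin._≟_ {n}) public

  record Block (k : ℕ) (xs : List (Fin n)) : Set where
    field
      elements : List (Fin n)
      size     : length elements ≡ k
      distinct : Unique elements
      inside   : ∀ {x} → x ∈ elements → x ∈ xs
      zero-sum : lsum elements ≡ 0g

  ZeroSum : ℕ → List (Fin n) → Set
  ZeroSum k b = length b ≡ k × lsum b ≡ 0g

  ++-zero-sum : ∀ {a b} A B → ZeroSum a A → ZeroSum b B → ZeroSum (a + b) (A ++ B)
  ++-zero-sum A B (A-size , A-sum) (B-size , B-sum) =
    trans (length-++ A) (cong₂ _+_ A-size B-size) , trans (lsum-++ A B) (trans (cong₂ _⊕_ A-sum B-sum) (identityˡ 0g))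

  concat-zero-sum : ∀ {k bs} → All (ZeroSum k) bs → ZeroSum (k * length bs) (concat bs)
  concat-zero-sum {k} [] = sym (*-zeroʳ k) , refl
  concat-zero-sum {k} {b ∷ bs} (b-zero ∷ bs-zero) =
    Product.map₁ (λ e → trans e (sym (*-suc k (length bs)))) (++-zero-sum b (concat bs) b-zero (concat-zero-sum bs-zero))

  concat-zero-sums : ∀ {ks As} → Pointwise ZeroSum ks As → ZeroSum (sum ks) (concat As)
  concat-zero-sums [] = refl , refl
  concat-zero-sums {As = A ∷ As} (A-zero ∷ As-zero) = ++-zero-sum A (concat As) A-zero (concat-zero-sums As-zero)

  Extraction : ℕ → ℕ → List (Fin n) → Set
  Extraction k t xs = ∃₂ λ bs rest → xs ↭ concat bs ++ rest × length bs ≡ t × All (ZeroSum k) bs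

  length-∖-block : ∀ {k xs} → Unique xs → (b : Block k xs) → length xs ≡ k + length (xs ∖ Block.elements b)
  length-∖-block xs! b = trans (↭-length (↭-++-∖ xs! distinct inside)) (trans (length-++ elements) (cong (_+ _) size))
    where open Block b

  extract-blocks : ∀ {k} (I : ℕ → List (Fin n) → Set) →
                   (∀ {t xs} → Unique xs → I (suc t) xs → Σ (Block k xs) λ b → I t (xs ∖ Block.elements b)) →
                   ∀ t xs → Unique xs → I t xs → Extraction k t xs
  extract-blocks I find zero xs _ _ = [] , xs , ↭-refl , refl , []
  extract-blocks {k} I find (suc t) xs xs! i = prepend (find xs! i)
    where
    prepend : Σ (Block k xs) (λ b → I t (xs ∖ Block.elements b)) → Extraction k (suc t) xs
    prepend (b , i′) = cons (extract-blocks I find t (xs ∖ elements) (Unique-∖ elements xs!) i′)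
      where
      open Block b
      cons : Extraction k t (xs ∖ elements) → Extraction k (suc t) xs
      cons (bs , rest , xs∖b↭ , len , blocks) =
        elements ∷ bs , rest ,
        ↭-trans (↭-++-∖ xs! distinct inside)
                (↭-trans (++⁺ˡ elements xs∖b↭) (↭-reflexive (sym (++-assoc elements _ _)))) ,
        cong suc len , (size , zero-sum) ∷ blocks

-- Zero-sum triples

module ZeroSumTriples {n : ℕ} (G : FinAbGroup n) where
  open GroupSums G
  open ZeroSumBlocks G

  -- Translating by some g with g ⊕ g ≢ 0g turns solutions of y ⊕ y = c into non-solutions.
  count-halves≤ : ∀ c → c ≢ 0g → count (λ y → y ⊕ y == c) + count (λ y → y ⊕ y == c) ≤ n
  count-halves≤ c c≢0 with Fin.all? (λ g → (g ⊕ g) Fin.≟ 0g)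
  ... | yes doubles-vanish = subst (λ m → m + m ≤ n) (sym (count-none no-half)) z≤n
    where
    no-half : ∀ y → y ⊕ y == c ≡ false
    no-half y = dec-false ((y ⊕ y) Fin.≟ c) (λ e → c≢0 (trans (sym e) (doubles-vanish y)))
  ... | no ¬doubles-vanish with Fin.¬∀⟶∃¬ n _ (λ g → (g ⊕ g) Fin.≟ 0g) ¬doubles-vanish
  ... | g , 2g≢0 = begin
    count H + count H
      ≡⟨ cong (count H +_) (sym (count-∘-bijection H (_⊕ g) (_⊕ (⊖ g)) cancel cancel′)) ⟩
    count H + count (λ y → H (y ⊕ g))
      ≤⟨ count-∧≥ H (λ y → H (y ⊕ g)) ⟩
    count (λ y → H y ∧ H (y ⊕ g)) + n
      ≡⟨ cong (_+ n) (count-none disjoint) ⟩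
    n ∎
    where
    open ≤-Reasoning
    H : Fin n → Bool
    H y = y ⊕ y == c
    cancel : ∀ y → (y ⊕ (⊖ g)) ⊕ g ≡ y
    cancel y = trans (assoc y (⊖ g) g) (trans (cong (y ⊕_) (inverseˡ g)) (identityʳ y))
    cancel′ : ∀ y → (y ⊕ g) ⊕ (⊖ g) ≡ y
    cancel′ y = trans (assoc y g (⊖ g)) (trans (cong (y ⊕_) (inverseʳ g)) (identityʳ y))
    disjoint : ∀ y → H y ∧ H (y ⊕ g) ≡ false
    disjoint y with H y in h₁ | H (y ⊕ g) in h₂
    ... | false | _ = refl
    ... | true | false = refl
    ... | true | true = contradiction (double-translation (==⇒≡ h₁) (==⇒≡ h₂)) 2g≢0

  complement : Fin n → Fin n → Fin n
  complement x y = ⊖ (x ⊕ y)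

  completes : ∀ x y → x ⊕ (y ⊕ complement x y) ≡ 0g
  completes x y = trans (sym (assoc x y (complement x y))) (inverseʳ (x ⊕ y))

  complement-involutive : ∀ x y → complement x (complement x y) ≡ y
  complement-involutive x y = sym (inverseʳ-unique (x ⊕ complement x y) y
    (trans (assoc x (complement x y) y) (trans (cong (x ⊕_) (comm (complement x y) y)) (completes x y))))

  complement-fixed : ∀ x {y} → y ≡ complement x y → y ⊕ y ≡ ⊖ x
  complement-fixed x {y} e = trans (cong (y ⊕_) e) (inverseʳ-unique x (y ⊕ complement x y) (completes x y))

  fewer-bad-than-pairs : ∀ {a e m p q} → a ≤ 2 + e → e + e ≤ m → q + q ≤ p + m → 3 * m + 5 ≤ 4 * q → a < p
  fewer-bad-than-pairs {a} {e} {m} {p} {q} a≤ e≤ q≤ dense = ≰⇒> λ p≤a → <-irrefl refl (begin-strict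
    3 * m + 4                    <⟨ +-monoʳ-< (3 * m) (n<1+n 4) ⟩
    3 * m + 5                    ≤⟨ dense ⟩
    4 * q                        ≡⟨ eq₁ q ⟩
    (q + q) + (q + q)            ≤⟨ +-mono-≤ q≤ q≤ ⟩
    (p + m) + (p + m)            ≤⟨ +-mono-≤ (+-monoˡ-≤ m (≤-trans p≤a a≤)) (+-monoˡ-≤ m (≤-trans p≤a a≤)) ⟩
    (2 + e + m) + (2 + e + m)    ≡⟨ eq₂ e m ⟩
    4 + (e + e) + (m + m)        ≤⟨ +-monoˡ-≤ (m + m) (+-monoʳ-≤ 4 e≤) ⟩
    4 + m + (m + m)              ≡⟨ eq₃ m ⟩
    3 * m + 4                    ∎)
    where
    open ≤-Reasoning
    eq₁ : ∀ q → 4 * q ≡ (q + q) + (q + q)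
    eq₁ = solve-∀
    eq₂ : ∀ e m → (2 + e + m) + (2 + e + m) ≡ 4 + (e + e) + (m + m)
    eq₂ = solve-∀
    eq₃ : ∀ m → 4 + m + (m + m) ≡ 3 * m + 4
    eq₃ = solve-∀

  completing-pair : ∀ (Q : Fin n → Bool) x → x ≢ 0g → 3 * n + 5 ≤ 4 * count Q →
                    ∃ λ y → Q y ∧ Q (complement x y) ≡ true × y ≢ x × complement x y ≢ x × y ≢ complement x y
  completing-pair Q x x≢0 dense = y , proj₁ (proj₂ good-pair) ,
    ==⇒≢ (proj₁ not-bad) , ==⇒≢ (proj₁ (proj₂ not-bad)) , ==⇒≢ (proj₂ (proj₂ not-bad)) ∘ complement-fixed x
    where
    Pairs Halves Bad : Fin n → Bool
    Pairs z = Q z ∧ Q (complement x z)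
    Halves z = z ⊕ z == ⊖ x
    Bad z = (z == x) ∨ ((complement x z == x) ∨ Halves z)
    many-pairs : count Q + count Q ≤ count Pairs + n
    many-pairs = subst (λ m → count Q + m ≤ count Pairs + n)
      (count-∘-bijection Q (complement x) (complement x) (complement-involutive x) (complement-involutive x))
      (count-∧≥ Q (Q ∘ complement x))
    few-bad : count Bad ≤ 2 + count Halves
    few-bad = begin
      count Bad
        ≤⟨ count-∨≤ (_== x) _ ⟩
      count (_== x) + count (λ z → (complement x z == x) ∨ Halves z)
        ≤⟨ +-mono-≤ (count≤1 x (λ _ → ==⇒≡)) (count-∨≤ (λ z → complement x z == x) Halves) ⟩
      1 + (count (λ z → complement x z == x) + count Halves)
        ≤⟨ +-monoʳ-≤ 1 (+-monoˡ-≤ (count Halves) (count≤1 (complement x x) only-cx)) ⟩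
      2 + count Halves ∎
      where
      open ≤-Reasoning
      only-cx : ∀ z → complement x z == x ≡ true → z ≡ complement x x
      only-cx z e = trans (sym (complement-involutive x z)) (cong (complement x) (==⇒≡ e))
    ⊖x≢0 : ⊖ x ≢ 0g
    ⊖x≢0 e = x≢0 (⁻¹-injective (trans e (sym ε⁻¹≈ε)))
    good-pair : ∃ λ y → Pairs y ≡ true × Bad y ≡ false
    good-pair = ∃-avoiding Pairs Bad
      (fewer-bad-than-pairs {count Bad} {count Halves} {n} {count Pairs} {count Q} few-bad (count-halves≤ (⊖ x) ⊖x≢0) many-pairs dense)
    y : Fin n
    y = proj₁ good-pair
    not-bad : y == x ≡ false × complement x y == x ≡ false × Halves y ≡ false
    not-bad = Product.map₂ ∨-false (∨-false (proj₂ (proj₂ good-pair)))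

  zero-sum-triple : ∀ xs → Unique xs → 3 * n + 5 ≤ 4 * length xs → Block 3 xs
  zero-sum-triple xs xs! dense = record
    { elements = x ∷ y ∷ complement x y ∷ []
    ; size     = refl
    ; distinct = (y≢x ∘ sym ∷ cy≢x ∘ sym ∷ []) ∷ (y≢cy ∷ []) ∷ [] ∷ []
    ; inside   = λ where
        (here refl)                 → ∈ᵇ⇒∈ Qx
        (there (here refl))         → ∈ᵇ⇒∈ (proj₁ (∧-true Pair))
        (there (there (here refl))) → ∈ᵇ⇒∈ (proj₂ (∧-true Pair))
    ; zero-sum = trans (cong (λ z → x ⊕ (y ⊕ z)) (identityʳ (complement x y))) (completes x y)
    }
    where
    Q : Fin n → Bool
    Q = _∈ᵇ xs
    dense-Q : 3 * n + 5 ≤ 4 * count Q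
    dense-Q = subst (λ m → 3 * n + 5 ≤ 4 * m) (sym (count-∈ᵇ xs!)) dense
    two-members : 1 < count Q
    two-members = ≰⇒> λ Q≤1 → <-irrefl refl (≤-trans (m≤n+m 5 (3 * n)) (≤-trans dense-Q (*-monoʳ-≤ 4 Q≤1)))
    nonzero-member : ∃ λ x → Q x ≡ true × x == 0g ≡ false
    nonzero-member = ∃-avoiding Q (_== 0g) (≤-<-trans (count≤1 0g (λ _ → ==⇒≡)) two-members)
    x : Fin n
    x = proj₁ nonzero-member
    Qx : Q x ≡ true
    Qx = proj₁ (proj₂ nonzero-member)
    pair : ∃ λ y → Q y ∧ Q (complement x y) ≡ true × y ≢ x × complement x y ≢ x × y ≢ complement x y
    pair = completing-pair Q x (==⇒≢ (proj₂ (proj₂ nonzero-member))) dense-Q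
    y : Fin n
    y = proj₁ pair
    Pair : Q y ∧ Q (complement x y) ≡ true
    Pair = proj₁ (proj₂ pair)
    y≢x : y ≢ x
    y≢x = proj₁ (proj₂ (proj₂ pair))
    cy≢x : complement x y ≢ x
    cy≢x = proj₁ (proj₂ (proj₂ (proj₂ pair)))
    y≢cy : y ≢ complement x y
    y≢cy = proj₂ (proj₂ (proj₂ (proj₂ pair)))

  zero-sum-triples : ∀ t xs → Unique xs → 3 * n + 5 + 12 * t ≤ 4 * length xs → Extraction 3 t xs
  zero-sum-triples = extract-blocks (λ t xs → 3 * n + 5 + 12 * t ≤ 4 * length xs) remove-triple
    where
    remove-triple : ∀ {t xs} → Unique xs → 3 * n + 5 + 12 * suc t ≤ 4 * length xs →
                    Σ (Block 3 xs) λ b → 3 * n + 5 + 12 * t ≤ 4 * length (xs ∖ Block.elements b)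
    remove-triple {t} {xs} xs! dense = b , +-cancelˡ-≤ 12 (3 * n + 5 + 12 * t) (4 * length rest) (begin
      12 + (3 * n + 5 + 12 * t)     ≡⟨ eq₁ (3 * n + 5) t ⟩
      3 * n + 5 + 12 * suc t        ≤⟨ dense ⟩
      4 * length xs                 ≡⟨ cong (4 *_) (length-∖-block xs! b) ⟩
      4 * (3 + length rest)         ≡⟨ eq₂ (length rest) ⟩
      12 + 4 * length rest          ∎)
      where
      open ≤-Reasoning
      b : Block 3 xs
      b = zero-sum-triple xs xs! (≤-trans (m≤m+n _ _) dense)
      rest : List (Fin n)
      rest = xs ∖ Block.elements b
      eq₁ : ∀ c t → 12 + (c + 12 * t) ≡ c + 12 * suc t
      eq₁ = solve-∀
      eq₂ : ∀ l → 4 * (3 + l) ≡ 12 + 4 * l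
      eq₂ = solve-∀

-- Zero-sum quadruples

module ZeroSumQuadruples {n : ℕ} (G : FinAbGroup n) where
  open GroupSums G
  open ZeroSumBlocks G

  order-two-element : ∃ λ a → a ⊕ a ≡ 0g × (a ≡ 0g → ∀ g → g ⊕ g ≡ 0g → g ≡ 0g)
  order-two-element with Fin.any? (λ g → ((g ⊕ g) Fin.≟ 0g) ×-dec ¬? (g Fin.≟ 0g))
  ... | yes (a , 2a≡0 , a≢0) = a , 2a≡0 , λ a≡0 → contradiction a≡0 a≢0
  ... | no none = 0g , identityˡ 0g , λ _ g 2g≡0 → decidable-stable (g Fin.≟ 0g) (λ g≢0 → none (g , 2g≡0 , g≢0))

  a : Fin n
  a = proj₁ order-two-element

  2a≡0 : a ⊕ a ≡ 0g
  2a≡0 = proj₁ (proj₂ order-two-element)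

  self-inverse : Fin n → Bool
  self-inverse x = x ⊕ x == 0g

  σ : Fin n → Fin n
  σ x = if self-inverse x then x ⊕ a else ⊖ x

  pair-sum : Fin n → Fin n
  pair-sum x = if self-inverse x then a else 0g

  self-inverse-σ : ∀ x → self-inverse (σ x) ≡ self-inverse x
  self-inverse-σ x with self-inverse x in e
  ... | true = dec-true (_ Fin.≟ _) (begin
    (x ⊕ a) ⊕ (x ⊕ a)   ≡⟨ interchange x a x a ⟩
    (x ⊕ x) ⊕ (a ⊕ a)   ≡⟨ cong₂ _⊕_ (==⇒≡ e) 2a≡0 ⟩
    0g ⊕ 0g             ≡⟨ identityˡ 0g ⟩
    0g                  ∎)
    where open ≡-Reasoning
  ... | false = dec-false (_ Fin.≟ _) λ 2[⊖x]≡0 →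
    ==⇒≢ e (⁻¹-injective (trans (sym (⁻¹-∙-comm x x)) (trans 2[⊖x]≡0 (sym ε⁻¹≈ε))))

  σ-involutive : ∀ x → σ (σ x) ≡ x
  σ-involutive x rewrite self-inverse-σ x with self-inverse x
  ... | true = trans (assoc x a a) (trans (cong (x ⊕_) 2a≡0) (identityʳ x))
  ... | false = ⁻¹-involutive x

  σ-fixed : ∀ x → σ x ≡ x → x ≡ 0g
  σ-fixed x σx≡x with self-inverse x in e
  ... | true = proj₂ (proj₂ order-two-element) (identityʳ-unique x a σx≡x) x (==⇒≡ e)
  ... | false = contradiction (trans (cong (x ⊕_) (sym σx≡x)) (inverseʳ x)) (==⇒≢ e)

  σ-pair-sum : ∀ x → x ⊕ σ x ≡ pair-sum x
  σ-pair-sum x with self-inverse x in e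
  ... | true = trans (sym (assoc x x a)) (trans (cong (_⊕ a) (==⇒≡ e)) (identityˡ a))
  ... | false = inverseʳ x

  pair-sum-doubled : ∀ x → pair-sum x ⊕ pair-sum x ≡ 0g
  pair-sum-doubled x with self-inverse x
  ... | true = 2a≡0
  ... | false = identityˡ 0g

  σ-injective : ∀ {x y} → σ x ≡ σ y → x ≡ y
  σ-injective {x} {y} e = trans (sym (σ-involutive x)) (trans (cong σ e) (σ-involutive y))

  σ-Closed : List (Fin n) → Set
  σ-Closed xs = ∀ {x} → x ∈ xs → σ x ∈ xs

  σ-quadruple : ∀ {xs x y} → σ-Closed xs → x ∈ xs → y ∈ xs → x ≢ 0g → y ≢ 0g → y ≢ x → y ≢ σ x →
                self-inverse x ≡ self-inverse y → Σ (Block 4 xs) (σ-Closed ∘ Block.elements)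
  σ-quadruple {xs} {x} {y} closed x∈ y∈ x≢0 y≢0 y≢x y≢σx same-type = block , block-closed
    where
    elements : List (Fin n)
    elements = x ∷ σ x ∷ y ∷ σ y ∷ []
    unfixed : ∀ {z} → z ≢ 0g → z ≢ σ z
    unfixed z≢0 e = z≢0 (σ-fixed _ (sym e))
    block : Block 4 xs
    block = record
      { elements = elements
      ; size = refl
      ; distinct = (unfixed x≢0 ∷ y≢x ∘ sym ∷ (λ e → y≢σx (trans (sym (σ-involutive y)) (cong σ (sym e)))) ∷ [])
                 ∷ (y≢σx ∘ sym ∷ (λ e → y≢x (sym (σ-injective e))) ∷ [])
                 ∷ (unfixed y≢0 ∷ []) ∷ [] ∷ []
      ; inside = λ where
          (here refl)                         → x∈
          (there (here refl))                 → closed x∈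
          (there (there (here refl)))         → y∈
          (there (there (there (here refl)))) → closed y∈
      ; zero-sum = begin
          x ⊕ (σ x ⊕ (y ⊕ (σ y ⊕ 0g)))    ≡⟨ cong (λ z → x ⊕ (σ x ⊕ (y ⊕ z))) (identityʳ (σ y)) ⟩
          x ⊕ (σ x ⊕ (y ⊕ σ y))           ≡⟨ sym (assoc x (σ x) _) ⟩
          (x ⊕ σ x) ⊕ (y ⊕ σ y)           ≡⟨ cong₂ _⊕_ (σ-pair-sum x) (σ-pair-sum y) ⟩
          pair-sum x ⊕ pair-sum y         ≡⟨ cong (λ b → pair-sum x ⊕ (if b then a else 0g)) (sym same-type) ⟩
          pair-sum x ⊕ pair-sum x         ≡⟨ pair-sum-doubled x ⟩
          0g                              ∎
      }
      where open ≡-Reasoning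
    block-closed : σ-Closed elements
    block-closed (here refl) = there (here refl)
    block-closed (there (here refl)) = subst (_∈ elements) (sym (σ-involutive x)) (here refl)
    block-closed (there (there (here refl))) = there (there (there (here refl)))
    block-closed (there (there (there (here refl)))) = subst (_∈ elements) (sym (σ-involutive y)) (there (there (here refl)))

  quadruple-of-one-type : ∀ {xs} (T : Fin n → Bool) → σ-Closed xs → (∀ {z} → T z ≡ true → z ∈ xs × z ≢ 0g) →
                          (∀ {z w} → T z ≡ true → T w ≡ true → self-inverse z ≡ self-inverse w) → 3 ≤ count T →
                          Σ (Block 4 xs) (σ-Closed ∘ Block.elements)
  quadruple-of-one-type T closed member same-type three =
    σ-quadruple closed (proj₁ (member Tx)) (proj₁ (member Ty)) (proj₂ (member Tx)) (proj₂ (member Ty))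
                (==⇒≢ (proj₁ y-avoids)) (==⇒≢ (proj₂ y-avoids)) (same-type Tx Ty)
    where
    x-choice : ∃ λ x → T x ≡ true
    x-choice = ∃-member T (≤-trans (s≤s z≤n) three)
    x : Fin n
    x = proj₁ x-choice
    Tx : T x ≡ true
    Tx = proj₂ x-choice
    y-choice : ∃ λ y → T y ≡ true × (y == x) ∨ (y == σ x) ≡ false
    y-choice = ∃-avoiding T (λ z → (z == x) ∨ (z == σ x))
      (≤-<-trans (≤-trans (count-∨≤ (_== x) (_== σ x))
                          (+-mono-≤ (count≤1 x (λ _ → ==⇒≡)) (count≤1 (σ x) (λ _ → ==⇒≡))))
                 three)
    Ty : T (proj₁ y-choice) ≡ true
    Ty = proj₁ (proj₂ y-choice)
    y-avoids : proj₁ y-choice == x ≡ false × proj₁ y-choice == σ x ≡ false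
    y-avoids = ∨-false (proj₂ (proj₂ y-choice))

  zero-sum-quadruple : ∀ xs → σ-Closed xs → 6 ≤ length xs → Unique xs → Σ (Block 4 xs) (σ-Closed ∘ Block.elements)
  zero-sum-quadruple xs closed big xs! = of-type (3 ≤? count SelfInverse)
    where
    Q Nonzero SelfInverse Other : Fin n → Bool
    Q = _∈ᵇ xs
    Nonzero z = Q z ∧ not (z == 0g)
    SelfInverse z = Nonzero z ∧ self-inverse z
    Other z = Nonzero z ∧ not (self-inverse z)
    at-most-one-zero : count Q ≤ 1 + count Nonzero
    at-most-one-zero = begin
      count Q
        ≡⟨ sym (count-∧-not Q (_== 0g)) ⟩
      count (λ z → Q z ∧ (z == 0g)) + count Nonzero
        ≤⟨ +-monoˡ-≤ (count Nonzero) (count≤1 0g (λ _ → ==⇒≡ ∘ proj₂ ∘ ∧-true)) ⟩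
      1 + count Nonzero ∎
      where open ≤-Reasoning
    five : 5 ≤ count SelfInverse + count Other
    five = subst (5 ≤_) (sym (count-∧-not Nonzero self-inverse))
             (+-cancelˡ-≤ 1 5 (count Nonzero) (≤-trans (subst (6 ≤_) (sym (count-∈ᵇ xs!)) big) at-most-one-zero))
    nonzero-member : ∀ {z} → Nonzero z ≡ true → z ∈ xs × z ≢ 0g
    nonzero-member Nz = ∈ᵇ⇒∈ (proj₁ (∧-true Nz)) , ==⇒≢ (not-true (proj₂ (∧-true Nz)))
    of-type : Dec (3 ≤ count SelfInverse) → Σ (Block 4 xs) (σ-Closed ∘ Block.elements)
    of-type (yes three) = quadruple-of-one-type SelfInverse closed (nonzero-member ∘ proj₁ ∘ ∧-true)
      (λ Tz Tw → trans (proj₂ (∧-true Tz)) (sym (proj₂ (∧-true Tw))))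
      three
    of-type (no ¬three) = quadruple-of-one-type Other closed (nonzero-member ∘ proj₁ ∘ ∧-true)
      (λ Tz Tw → trans (not-true (proj₂ (∧-true Tz))) (sym (not-true (proj₂ (∧-true Tw)))))
      (+-cancelˡ-≤ 2 3 (count Other) (≤-trans five (+-monoˡ-≤ (count Other) (≤-pred (≰⇒> ¬three)))))

  ∖-σ-closed : ∀ {xs ys} → σ-Closed xs → σ-Closed ys → σ-Closed (xs ∖ ys)
  ∖-σ-closed xs-closed ys-closed z∈ with ∈-∖⁻ z∈
  ... | z∈xs , z∉ys =
    ∈-∖⁺ (xs-closed z∈xs) (λ σz∈ys → z∉ys (subst (_∈ _) (σ-involutive _) (ys-closed σz∈ys)))

  paired : List (Fin n) → List (Fin n)
  paired xs = filter (λ z → DecMembership._∈?_ Fin._≟_ (σ z) xs) xs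

  ∈-paired⁻ : ∀ {xs z} → z ∈ paired xs → z ∈ xs × σ z ∈ xs
  ∈-paired⁻ {xs} = ∈-filter⁻ (λ z → DecMembership._∈?_ Fin._≟_ (σ z) xs) {xs = xs}

  ∈-paired⁺ : ∀ {xs z} → z ∈ xs → σ z ∈ xs → z ∈ paired xs
  ∈-paired⁺ {xs} = ∈-filter⁺ (λ z → DecMembership._∈?_ Fin._≟_ (σ z) xs)

  σ-closed-paired : ∀ xs → σ-Closed (paired xs)
  σ-closed-paired xs z∈ with ∈-paired⁻ z∈
  ... | z∈xs , σz∈xs = ∈-paired⁺ σz∈xs (subst (_∈ xs) (sym (σ-involutive _)) z∈xs)

  Unique-paired : ∀ {xs} → Unique xs → Unique (paired xs)
  Unique-paired {xs} = Unique.filter⁺ (λ z → DecMembership._∈?_ Fin._≟_ (σ z) xs)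

  length-paired : ∀ {xs} → Unique xs → length xs + length xs ≤ length (paired xs) + n
  length-paired {xs} xs! = begin
    length xs + length xs
      ≡⟨ sym (cong₂ _+_ (count-∈ᵇ xs!)
                        (trans (count-∘-bijection _ σ σ σ-involutive σ-involutive) (count-∈ᵇ xs!))) ⟩
    count (_∈ᵇ xs) + count (λ z → σ z ∈ᵇ xs)
      ≤⟨ count-∧≥ (_∈ᵇ xs) (λ z → σ z ∈ᵇ xs) ⟩
    count (λ z → z ∈ᵇ xs ∧ σ z ∈ᵇ xs) + n
      ≡⟨ cong (_+ n) (count≡length (Unique-paired xs!) (mk⇔ to from)) ⟩
    length (paired xs) + n ∎
    where
    open ≤-Reasoning
    to : ∀ {z} → z ∈ paired xs → z ∈ᵇ xs ∧ σ z ∈ᵇ xs ≡ true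
    to z∈ = cong₂ _∧_ (∈⇒∈ᵇ (proj₁ (∈-paired⁻ {xs} z∈))) (∈⇒∈ᵇ (proj₂ (∈-paired⁻ {xs} z∈)))
    from : ∀ {z} → z ∈ᵇ xs ∧ σ z ∈ᵇ xs ≡ true → z ∈ paired xs
    from both = ∈-paired⁺ (∈ᵇ⇒∈ (proj₁ (∧-true both))) (∈ᵇ⇒∈ (proj₂ (∧-true both)))

  QuadrupleRoom : ℕ → List (Fin n) → Set
  QuadrupleRoom t ys = σ-Closed ys × 5 + 4 * t ≤ length ys

  remove-quadruple : ∀ {t ys} → Unique ys → QuadrupleRoom (suc t) ys →
                     Σ (Block 4 ys) λ b → QuadrupleRoom t (ys ∖ Block.elements b)
  remove-quadruple {t} {ys} ys! (closed , room) = b , ∖-σ-closed closed b-closed ,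
    +-cancelˡ-≤ 4 _ _ (≤-trans (≤-reflexive (eq₂ t)) (≤-trans room (≤-reflexive (length-∖-block ys! b))))
    where
    eq₁ : ∀ t → 3 + 4 * t + 6 ≡ 5 + 4 * suc t
    eq₁ = solve-∀
    eq₂ : ∀ t → 4 + (5 + 4 * t) ≡ 5 + 4 * suc t
    eq₂ = solve-∀
    quadruple : Σ (Block 4 ys) (σ-Closed ∘ Block.elements)
    quadruple = zero-sum-quadruple ys closed (≤-trans (m≤n+m 6 (3 + 4 * t)) (≤-trans (≤-reflexive (eq₁ t)) room)) ys!
    b : Block 4 ys
    b = proj₁ quadruple
    b-closed : σ-Closed (Block.elements b)
    b-closed = proj₂ quadruple

  zero-sum-quadruples : ∀ t xs → Unique xs → 5 + 4 * t + n ≤ length xs + length xs → Extraction 4 t xs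
  zero-sum-quadruples t xs xs! many with extract-blocks QuadrupleRoom remove-quadruple t (paired xs) (Unique-paired xs!)
                                            (σ-closed-paired xs , +-cancelʳ-≤ n _ _ (≤-trans many (length-paired xs!)))
  ... | qs , rest , paired↭ , len , blocks =
    qs , rest ++ xs ∖ paired xs ,
    ↭-trans (↭-++-∖ xs! (Unique-paired xs!) (proj₁ ∘ ∈-paired⁻))
            (↭-trans (++⁺ʳ _ paired↭) (↭-reflexive (++-assoc (concat qs) rest _))) ,
    len , blocks

-- Splitting a dense zero-sum set into zero-sum parts of prescribed sizes

threes : ℕ → ℕ
threes 6 = 2
threes 7 = 1
threes 9 = 3
threes (suc (suc (suc (suc k@(suc (suc (suc (suc (suc (suc _)))))))))) = threes k
threes _ = 0

fours : ℕ → ℕ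
fours 7 = 1
fours 8 = 2
fours (suc (suc (suc (suc k@(suc (suc (suc (suc (suc (suc _)))))))))) = suc (fours k)
fours _ = 0

Admissible : ℕ → Set
Admissible k = k ≡ 0 ⊎ 6 ≤ k

threes-and-fours : ∀ {k} → Admissible k → 3 * threes k + 4 * fours k ≡ k
threes-and-fours {0} _ = refl
threes-and-fours {6} _ = refl
threes-and-fours {7} _ = refl
threes-and-fours {8} _ = refl
threes-and-fours {9} _ = refl
threes-and-fours {suc (suc (suc (suc k@(suc (suc (suc (suc (suc (suc _)))))))))} _ =
  trans (eq (threes k) (fours k)) (cong (4 +_) (threes-and-fours {k} (inj₂ (m≤m+n 6 _))))
  where
  eq : ∀ b c → 3 * b + 4 * suc c ≡ 4 + (3 * b + 4 * c)
  eq = solve-∀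
threes-and-fours {1} (inj₂ (s≤s ()))
threes-and-fours {2} (inj₂ (s≤s (s≤s ())))
threes-and-fours {3} (inj₂ (s≤s (s≤s (s≤s ()))))
threes-and-fours {4} (inj₂ (s≤s (s≤s (s≤s (s≤s ())))))
threes-and-fours {5} (inj₂ (s≤s (s≤s (s≤s (s≤s (s≤s ()))))))

threes≤3 : ∀ k → threes k ≤ 3
threes≤3 0 = z≤n
threes≤3 1 = z≤n
threes≤3 2 = z≤n
threes≤3 3 = z≤n
threes≤3 4 = z≤n
threes≤3 5 = z≤n
threes≤3 6 = s≤s (s≤s z≤n)
threes≤3 7 = s≤s z≤n
threes≤3 8 = z≤n
threes≤3 9 = ≤-refl
threes≤3 (suc (suc (suc (suc k@(suc (suc (suc (suc (suc (suc _)))))))))) = threes≤3 k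

sum-threes≤ : ∀ ks → sum (map threes ks) ≤ 3 * length ks
sum-threes≤ [] = z≤n
sum-threes≤ (k ∷ ks) = ≤-trans (+-mono-≤ (threes≤3 k) (sum-threes≤ ks)) (≤-reflexive (sym (*-suc 3 (length ks))))

4*sum-fours≤sum : ∀ {ks} → All Admissible ks → 4 * sum (map fours ks) ≤ sum ks
4*sum-fours≤sum [] = z≤n
4*sum-fours≤sum {k ∷ ks} (k-adm ∷ ks-adm) = begin
  4 * (fours k + sum (map fours ks))
    ≡⟨ *-distribˡ-+ 4 (fours k) _ ⟩
  4 * fours k + 4 * sum (map fours ks)
    ≤⟨ +-mono-≤ (≤-trans (m≤n+m (4 * fours k) (3 * threes k)) (≤-reflexive (threes-and-fours k-adm)))
                (4*sum-fours≤sum ks-adm) ⟩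
  k + sum ks ∎
  where open ≤-Reasoning

sum≤length* : ∀ {c ks} → All (_≤ c) ks → sum ks ≤ length ks * c
sum≤length* [] = z≤n
sum≤length* (k≤c ∷ ks≤c) = +-mono-≤ k≤c (sum≤length* ks≤c)

largest-part-bound : ∀ {D X k* ks m} → All (_≤ k*) ks → length ks ≤ D → m ≡ k* + sum ks →
                     suc D * X ≤ m → X ≤ k*
largest-part-bound {D} {X} {k*} {ks} {m} ≤k* few m≡ dense = *-cancelˡ-≤ (suc D) (begin
  suc D * X                   ≤⟨ dense ⟩
  m                           ≡⟨ m≡ ⟩
  k* + sum ks                 ≤⟨ +-monoʳ-≤ k* (≤-trans (sum≤length* ≤k*) (*-monoˡ-≤ k* few)) ⟩
  k* + D * k*                 ≡⟨⟩
  suc D * k*                  ∎)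
  where open ≤-Reasoning

triples-fit : ∀ {D gap k* m n t} → t ≤ 3 * D → m + gap ≡ n → 3 * gap + 36 * D + 5 ≤ k* → k* ≤ m →
              3 * n + 5 + 12 * t ≤ 4 * m
triples-fit {D} {gap} {k*} {m} {n} {t} t≤ n≡ big k*≤m = begin
  3 * n + 5 + 12 * t                 ≡⟨ cong (λ x → 3 * x + 5 + 12 * t) (sym n≡) ⟩
  3 * (m + gap) + 5 + 12 * t         ≤⟨ +-monoʳ-≤ (3 * (m + gap) + 5) (*-monoʳ-≤ 12 t≤) ⟩
  3 * (m + gap) + 5 + 12 * (3 * D)   ≡⟨ eq₁ m gap D ⟩
  3 * m + (3 * gap + 36 * D + 5)     ≤⟨ +-monoʳ-≤ (3 * m) (≤-trans big k*≤m) ⟩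
  3 * m + m                          ≡⟨ eq₂ m ⟩
  4 * m                              ∎
  where
  open ≤-Reasoning
  eq₁ : ∀ m gap D → 3 * (m + gap) + 5 + 12 * (3 * D) ≡ 3 * m + (3 * gap + 36 * D + 5)
  eq₁ = solve-∀
  eq₂ : ∀ m → 3 * m + m ≡ 4 * m
  eq₂ = solve-∀

quadruples-fit : ∀ {D gap k* m m₁ n t c O} → t ≤ 3 * D → 4 * c ≤ O → m ≡ k* + O → m ≡ 3 * t + m₁ →
                 m + gap ≡ n → 3 * gap + 36 * D + 5 ≤ k* → 5 + 4 * c + n ≤ m₁ + m₁
quadruples-fit {D} {gap} {k*} {m} {m₁} {n} {t} {c} {O} t≤ c≤ m≡k*+O m≡3t+m₁ n≡ big = +-cancelʳ-≤ (6 * t) _ _ (begin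
  5 + 4 * c + n + 6 * t
    ≤⟨ +-mono-≤ (+-monoˡ-≤ n (+-monoʳ-≤ 5 c≤)) (*-monoʳ-≤ 6 t≤) ⟩
  5 + O + n + 6 * (3 * D)
    ≡⟨ cong (λ x → 5 + O + x + 6 * (3 * D)) (sym n≡) ⟩
  5 + O + (m + gap) + 6 * (3 * D)
    ≡⟨ eq₁ O m gap D ⟩
  (m + O) + (gap + 18 * D + 5)
    ≤⟨ +-monoʳ-≤ (m + O) (≤-trans (≤-trans (m≤m+n _ (2 * gap + 18 * D)) (≤-reflexive (eq₂ gap D))) big) ⟩
  (m + O) + k*
    ≡⟨ cong (λ x → x + O + k*) m≡3t+m₁ ⟩
  (3 * t + m₁ + O) + k*
    ≡⟨ eq₃ t m₁ O k* ⟩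
  3 * t + m₁ + (k* + O)
    ≡⟨ cong (3 * t + m₁ +_) (trans (sym m≡k*+O) m≡3t+m₁) ⟩
  3 * t + m₁ + (3 * t + m₁)
    ≡⟨ eq₄ t m₁ ⟩
  m₁ + m₁ + 6 * t ∎)
  where
  open ≤-Reasoning
  eq₁ : ∀ O m gap D → 5 + O + (m + gap) + 6 * (3 * D) ≡ (m + O) + (gap + 18 * D + 5)
  eq₁ = solve-∀
  eq₂ : ∀ gap D → gap + 18 * D + 5 + (2 * gap + 18 * D) ≡ 3 * gap + 36 * D + 5
  eq₂ = solve-∀
  eq₃ : ∀ t m₁ O k* → (3 * t + m₁ + O) + k* ≡ 3 * t + m₁ + (k* + O)
  eq₃ = solve-∀
  eq₄ : ∀ t m₁ → 3 * t + m₁ + (3 * t + m₁) ≡ m₁ + m₁ + 6 * t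
  eq₄ = solve-∀

module Partition {n : ℕ} (G : FinAbGroup n) where
  open GroupSums G
  open ZeroSumBlocks G
  open ZeroSumTriples G
  open ZeroSumQuadruples G
  open CommutativeSemigroupProperties (CommutativeMonoid.commutativeSemigroup (++-commutativeMonoid {A = Fin n}))
    using () renaming (interchange to ++-interchange)

  distribute : ∀ ks (ts qs : List (List (Fin n))) → All Admissible ks → All (ZeroSum 3) ts → All (ZeroSum 4) qs →
               length ts ≡ sum (map threes ks) → length qs ≡ sum (map fours ks) →
               ∃ λ As → concat ts ++ concat qs ↭ concat As × Pointwise ZeroSum ks As
  distribute [] [] [] _ _ _ _ _ = [] , ↭-refl , []
  distribute (k ∷ ks) ts qs (k-adm ∷ ks-adm) ts-zero qs-zero ts-len qs-len
    with split-by-length ts (threes k) ts-len | split-by-length qs (fours k) qs-len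
  ... | T , ts′ , refl , T-len , ts′-len | Q , qs′ , refl , Q-len , qs′-len
    with All.++⁻ T ts-zero | All.++⁻ Q qs-zero
  ... | T-zero , ts′-zero | Q-zero , qs′-zero
    with distribute ks ts′ qs′ ks-adm ts′-zero qs′-zero ts′-len qs′-len
  ... | As , rest↭ , As-zero =
    (concat T ++ concat Q) ∷ As ,
    ↭-trans (↭-reflexive (sym (cong₂ _++_ (concat-++ T ts′) (concat-++ Q qs′))))
      (↭-trans (++-interchange (concat T) (concat ts′) (concat Q) (concat qs′)) (++⁺ˡ _ rest↭)) ,
    subst (λ m → ZeroSum m (concat T ++ concat Q))
      (trans (cong₂ (λ b c → 3 * b + 4 * c) T-len Q-len) (threes-and-fours k-adm))
      (++-zero-sum (concat T) (concat Q) (concat-zero-sum T-zero) (concat-zero-sum Q-zero)) ∷ As-zero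

  ZeroSumPartition : ℕ → List ℕ → List (Fin n) → Set
  ZeroSumPartition k* ks R = ∃₂ λ rest As → R ↭ rest ++ concat As × ZeroSum k* rest × Pointwise ZeroSum ks As

  leftover-part : ∀ {R blocks rest k* ks As} → lsum R ≡ 0g → length R ≡ k* + sum ks →
                  R ↭ blocks ++ rest → blocks ↭ concat As → Pointwise ZeroSum ks As → ZeroSumPartition k* ks R
  leftover-part {R} {blocks} {rest} {k*} {ks} {As} R-sum R-len R↭ blocks↭ As-zero =
    rest , As , R↭rest++As , (rest-len , rest-sum) , As-zero
    where
    R↭rest++As : R ↭ rest ++ concat As
    R↭rest++As = ↭-trans R↭ (↭-trans (++⁺ʳ rest blocks↭) (++-comm (concat As) rest))
    As-total : ZeroSum (sum ks) (concat As)
    As-total = concat-zero-sums As-zero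
    rest-len : length rest ≡ k*
    rest-len = +-cancelʳ-≡ (sum ks) (length rest) k* (begin
      length rest + sum ks                 ≡⟨ cong (length rest +_) (sym (proj₁ As-total)) ⟩
      length rest + length (concat As)     ≡⟨ sym (length-++ rest) ⟩
      length (rest ++ concat As)           ≡⟨ sym (↭-length R↭rest++As) ⟩
      length R                             ≡⟨ R-len ⟩
      k* + sum ks                          ∎)
      where open ≡-Reasoning
    rest-sum : lsum rest ≡ 0g
    rest-sum = begin
      lsum rest                        ≡⟨ sym (identityʳ (lsum rest)) ⟩
      lsum rest ⊕ 0g                   ≡⟨ cong (lsum rest ⊕_) (sym (proj₂ As-total)) ⟩
      lsum rest ⊕ lsum (concat As)     ≡⟨ sym (lsum-++ rest (concat As)) ⟩
      lsum (rest ++ concat As)         ≡⟨ sym (lsum-↭ R↭rest++As) ⟩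
      lsum R                           ≡⟨ R-sum ⟩
      0g                               ∎
      where open ≡-Reasoning

  zero-sum-partition :
    ∀ R → Unique R → lsum R ≡ 0g →
    ∀ D gap k* ks → All Admissible ks → All (_≤ k*) ks → length ks ≤ D →
    length R ≡ k* + sum ks → length R + gap ≡ n → suc D * (3 * gap + 36 * D + 5) ≤ length R →
    ZeroSumPartition k* ks R
  zero-sum-partition R R! R-sum D gap k* ks ks-adm ≤k* few R-len R-gap dense =
    after-triples (zero-sum-triples t R R! (triples-fit {D} {gap} {k*} {length R} {n} {t} t≤ R-gap big k*≤R))
    where
    t c : ℕ
    t = sum (map threes ks)
    c = sum (map fours ks)
    t≤ : t ≤ 3 * D
    t≤ = ≤-trans (sum-threes≤ ks) (*-monoʳ-≤ 3 few)
    big : 3 * gap + 36 * D + 5 ≤ k*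
    big = largest-part-bound {D} {3 * gap + 36 * D + 5} {k*} {ks} {length R} ≤k* few R-len dense
    k*≤R : k* ≤ length R
    k*≤R = subst (k* ≤_) (sym R-len) (m≤m+n k* _)
    after-triples : Extraction 3 t R → ZeroSumPartition k* ks R
    after-triples (ts , R₁ , R↭ , ts-len , ts-zero) = after-quadruples (zero-sum-quadruples c R₁ R₁! quadruples-fit′)
      where
      R₁! : Unique R₁
      R₁! = Unique-++⁻ʳ (concat ts) (Unique-resp-↭ R↭ R!)
      R≡3t+R₁ : length R ≡ 3 * t + length R₁
      R≡3t+R₁ = trans (↭-length R↭) (trans (length-++ (concat ts))
                  (cong (_+ length R₁) (trans (proj₁ (concat-zero-sum ts-zero)) (cong (3 *_) ts-len))))
      quadruples-fit′ : 5 + 4 * c + n ≤ length R₁ + length R₁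
      quadruples-fit′ = quadruples-fit {D} {gap} {k*} {length R} {length R₁} {n} {t} {c} {sum ks}
                          t≤ (4*sum-fours≤sum ks-adm) R-len R≡3t+R₁ R-gap big
      after-quadruples : Extraction 4 c R₁ → ZeroSumPartition k* ks R
      after-quadruples (qs , R₂ , R₁↭ , qs-len , qs-zero) with distribute ks ts qs ks-adm ts-zero qs-zero ts-len qs-len
      ... | As , blocks↭ , As-zero = leftover-part R-sum R-len R↭blocks++R₂ blocks↭ As-zero
        where
        R↭blocks++R₂ : R ↭ (concat ts ++ concat qs) ++ R₂
        R↭blocks++R₂ =
          ↭-trans R↭ (↭-trans (++⁺ˡ (concat ts) R₁↭) (↭-reflexive (sym (++-assoc (concat ts) (concat qs) R₂))))

module Tabulation {A B : Set} (_≟_ : DecidableEquality A) (default : B) where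

  lookup-assoc : List (A × B) → A → B
  lookup-assoc [] _ = default
  lookup-assoc ((a , b) ∷ ps) x = if does (x ≟ a) then b else lookup-assoc ps x

  map-lookup-zip : ∀ {as bs} → Unique as → length as ≡ length bs → map (lookup-assoc (zip as bs)) as ≡ bs
  map-lookup-zip {[]} {[]} _ _ = refl
  map-lookup-zip {a ∷ as} {b ∷ bs} (a∉as ∷ as!) len = cong₂ _∷_
    (cong (if_then b else lookup-assoc (zip as bs) a) (dec-true (a ≟ a) refl))
    (trans (map-cong-local (All.map skip a∉as)) (map-lookup-zip as! (suc-injective len)))
    where
    skip : ∀ {x} → a ≢ x → lookup-assoc ((a , b) ∷ zip as bs) x ≡ lookup-assoc (zip as bs) x
    skip {x} a≢x = cong (if_then b else lookup-assoc (zip as bs) x) (dec-false (x ≟ a) (a≢x ∘ sym))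

-- Extending φ to a pseudoembedding

module Extension {n N : ℕ} (G : FinAbGroup n) (T : Tree N) (Δ : ℕ) (V C : Fin n → Bool) (S : Fin N → Bool)
                 (φ : Fin N → Fin n) (bounded : ∀ v → deg T v ≤ Δ) (|V|≡N : count V ≡ N) (core : IsCore T Δ S)
                 (φ-injective : ∀ u v → S u ≡ true → S v ≡ true → φ u ≡ φ v → u ≡ v)
                 (φ-into : ∀ v → S v ≡ true → V (φ v) ≡ true)
                 (core-weighted-sum : gsum G (λ v → if-in S v (nmul G (deg T v) (φ v)) G) ≡ setSum G C)
                 (core-sum : gsum G (λ v → if-in S v (φ v) G) ≡ setSum G V) where
  open GroupSums G
  open ZeroSumBlocks G
  open Partition G

  InLayer : ℕ → Fin N → Bool
  InLayer d v = not (S v) ∧ (deg T v ℕ.≡ᵇ d)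

  layer : ℕ → List (Fin N)
  layer d = enum (InLayer d)

  ∈-layer⁻ : ∀ {d v} → v ∈ layer d → S v ≡ false × deg T v ≡ d
  ∈-layer⁻ v∈ = Product.map not-true (≡ᵇ⇒≡ _ _ ∘ Equivalence.from T-≡) (∧-true (∈-enum⁻ v∈))

  ∈-layer⁺ : ∀ {v} → S v ≡ false → v ∈ layer (deg T v)
  ∈-layer⁺ {v} Sv = ∈-enum⁺ (cong₂ _∧_ (cong not Sv) (Equivalence.to T-≡ (≡⇒≡ᵇ (deg T v) _ refl)))

  non-core : List ℕ → List (Fin N)
  non-core ds = concat (map layer ds)

  ∈-non-core⁻ : ∀ {ds v} → v ∈ non-core ds → S v ≡ false × deg T v ∈ ds
  ∈-non-core⁻ {d ∷ ds} v∈ with ∈-++⁻ (layer d) v∈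
  ... | inj₁ v∈d = proj₁ (∈-layer⁻ v∈d) , here (proj₂ (∈-layer⁻ v∈d))
  ... | inj₂ v∈ds = Product.map₂ there (∈-non-core⁻ v∈ds)

  ∈-non-core⁺ : ∀ {ds v} → S v ≡ false → deg T v ∈ ds → v ∈ non-core ds
  ∈-non-core⁺ {d ∷ ds} Sv (here refl) = ∈-++⁺ˡ (∈-layer⁺ Sv)
  ∈-non-core⁺ {d ∷ ds} Sv (there d∈) = ∈-++⁺ʳ (layer d) (∈-non-core⁺ Sv d∈)

  Unique-non-core : ∀ {ds} → Unique ds → Unique (non-core ds)
  Unique-non-core [] = []
  Unique-non-core {d ∷ ds} (d∉ds ∷ ds!) = Unique.++⁺ Unique-enum (Unique-non-core ds!) disjoint
    where
    disjoint : ∀ {v} → v ∈ layer d × v ∈ non-core ds → ⊥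
    disjoint (v∈d , v∈ds) =
      All.lookup d∉ds (subst (_∈ ds) (proj₂ (∈-layer⁻ v∈d)) (proj₂ (∈-non-core⁻ v∈ds))) refl

  length-non-core : ∀ ds → length (non-core ds) ≡ sum (map (length ∘ layer) ds)
  length-non-core [] = refl
  length-non-core (d ∷ ds) = trans (length-++ (layer d)) (cong (length (layer d) +_) (length-non-core ds))

  opaque
    d* : ℕ
    d* = argmax (length ∘ layer) 0 (upTo (suc Δ))

    d*-largest : All (λ d → length (layer d) ≤ length (layer d*)) (upTo (suc Δ))
    d*-largest = f[xs]≤f[argmax] 0 (upTo (suc Δ))

  others : List ℕ
  others = filter (λ d → ¬? (d ℕ.≟ d*)) (upTo (suc Δ))

  vertices : List (Fin N)
  vertices = enum S ++ non-core (d* ∷ others)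

  ∈-vertices : ∀ v → v ∈ vertices
  ∈-vertices v = by-cases (S v) refl (deg T v ℕ.≟ d*)
    where
    by-cases : ∀ b → S v ≡ b → Dec (deg T v ≡ d*) → v ∈ vertices
    by-cases true Sv _ = ∈-++⁺ˡ (∈-enum⁺ Sv)
    by-cases false Sv (yes deg≡d*) = ∈-++⁺ʳ (enum S) (∈-non-core⁺ {d* ∷ others} Sv (here deg≡d*))
    by-cases false Sv (no deg≢d*) = ∈-++⁺ʳ (enum S) (∈-non-core⁺ {d* ∷ others} Sv (there
      (∈-filter⁺ (λ d → ¬? (d ℕ.≟ d*)) (∈-upTo⁺ (s≤s (bounded v))) deg≢d*)))

  Unique-vertices : Unique vertices
  Unique-vertices = Unique.++⁺ Unique-enum (Unique-non-core classes!) disjoint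
    where
    others! : Unique others
    others! = Unique.filter⁺ (λ d → ¬? (d ℕ.≟ d*)) (Unique.upTo⁺ (suc Δ))
    classes! : Unique (d* ∷ others)
    classes! =
      All.tabulate (λ d∈ e → proj₂ (∈-filter⁻ (λ d → ¬? (d ℕ.≟ d*)) {xs = upTo (suc Δ)} d∈) (sym e)) ∷ others!
    disjoint : ∀ {v} → v ∈ enum S × v ∈ non-core (d* ∷ others) → ⊥
    disjoint (v∈S , v∈rest) =
      contradiction (trans (sym (∈-enum⁻ v∈S)) (proj₁ (∈-non-core⁻ {d* ∷ others} v∈rest))) λ ()

  vertices↭ : allFin N ↭ vertices
  vertices↭ = ↭-of-same-elements (Unique.allFin⁺ N) Unique-vertices
                (λ {v} → mk⇔ (λ _ → ∈-vertices v) (λ _ → ∈-allFin v))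

  length-vertices : length vertices ≡ N
  length-vertices = trans (sym (↭-length vertices↭)) (length-tabulate id)

  image : List (Fin n)
  image = map φ (enum S)

  Unique-image : Unique image
  Unique-image = Unique-map⁺-injectiveOn (λ u∈ v∈ → φ-injective _ _ (∈-enum⁻ u∈) (∈-enum⁻ v∈)) Unique-enum

  Remaining : Fin n → Bool
  Remaining x = V x ∧ not (x ∈ᵇ image)

  remaining : List (Fin n)
  remaining = enum Remaining

  targets↭ : enum V ↭ image ++ remaining
  targets↭ = ↭-of-same-elements Unique-enum (Unique.++⁺ Unique-image Unique-enum disjoint) (λ {x} → mk⇔ (to x) from)
    where
    disjoint : ∀ {x} → x ∈ image × x ∈ remaining → ⊥
    disjoint (x∈image , x∈rem) =
      contradiction (trans (sym (∈⇒∈ᵇ x∈image)) (not-true (proj₂ (∧-true (∈-enum⁻ x∈rem))))) λ ()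
    by-cases : ∀ x → V x ≡ true → ∀ b → x ∈ᵇ image ≡ b → x ∈ image ++ remaining
    by-cases x Vx true e = ∈-++⁺ˡ (∈ᵇ⇒∈ e)
    by-cases x Vx false e = ∈-++⁺ʳ image (∈-enum⁺ (cong₂ _∧_ Vx (cong not e)))
    to : ∀ x → x ∈ enum V → x ∈ image ++ remaining
    to x x∈V = by-cases x (∈-enum⁻ x∈V) (x ∈ᵇ image) refl
    from : ∀ {x} → x ∈ image ++ remaining → x ∈ enum V
    from x∈ with ∈-++⁻ image x∈
    ... | inj₁ x∈image with ∈-map⁻ φ x∈image
    ... | v , v∈S , refl = ∈-enum⁺ (φ-into v (∈-enum⁻ v∈S))
    from x∈ | inj₂ x∈rem = ∈-enum⁺ (proj₁ (∧-true (∈-enum⁻ x∈rem)))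

  length-image : length image ≡ count S
  length-image = trans (length-map φ (enum S)) (length-enum S)

  core+remaining : count S + length remaining ≡ N
  core+remaining = begin
    count S + length remaining           ≡⟨ cong (_+ length remaining) (sym length-image) ⟩
    length image + length remaining      ≡⟨ sym (length-++ image) ⟩
    length (image ++ remaining)          ≡⟨ sym (↭-length targets↭) ⟩
    length (enum V)                      ≡⟨ length-enum V ⟩
    count V                              ≡⟨ |V|≡N ⟩
    N                                    ∎
    where open ≡-Reasoning

  length-remaining : length remaining ≡ length (layer d*) + sum (map (length ∘ layer) others)
  length-remaining = +-cancelˡ-≡ (count S) _ _ (begin
    count S + length remaining
      ≡⟨ core+remaining ⟩
    N
      ≡⟨ sym length-vertices ⟩
    length vertices
      ≡⟨ length-++ (enum S) ⟩
    length (enum S) + length (non-core (d* ∷ others))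
      ≡⟨ cong₂ _+_ (length-enum S) (length-non-core (d* ∷ others)) ⟩
    count S + (length (layer d*) + sum (map (length ∘ layer) others)) ∎)
    where open ≡-Reasoning

  remaining-sum : lsum remaining ≡ 0g
  remaining-sum = identityʳ-unique (lsum image) (lsum remaining) (begin
    lsum image ⊕ lsum remaining          ≡⟨ sym (lsum-++ image remaining) ⟩
    lsum (image ++ remaining)            ≡⟨ sym (lsum-↭ targets↭) ⟩
    lsum (enum V)                        ≡⟨ sym (setSum-as-lsum V) ⟩
    setSum G V                           ≡⟨ sym core-sum ⟩
    gsum G (λ v → if-in S v (φ v) G)     ≡⟨ gsum-if S φ ⟩
    lsum image                           ∎)
    where open ≡-Reasoning

  layer-admissible : ∀ d → d ≤ Δ → Admissible (length (layer d))
  layer-admissible d d≤Δ = by-core (core d d≤Δ)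
    where
    outside : (∀ v → deg T v ≡ d → S v ≡ true) → ∀ v → InLayer d v ≡ false
    outside inside v = by-cases (InLayer d v) refl
      where
      by-cases : ∀ b → InLayer d v ≡ b → b ≡ false
      by-cases false _ = refl
      by-cases true e = contradiction (trans (sym (inside v (proj₂ v∈d))) (proj₁ v∈d)) λ ()
        where
        v∈d : S v ≡ false × deg T v ≡ d
        v∈d = ∈-layer⁻ (∈-enum⁺ e)
    by-core : (∀ v → deg T v ≡ d → S v ≡ true)
              ⊎ (6 ≤ count (λ v → S v ∧ (deg T v ℕ.≡ᵇ d)) × 6 ≤ count (InLayer d)) →
              Admissible (length (layer d))
    by-core (inj₁ inside) = inj₁ (trans (length-enum (InLayer d)) (count-none (outside inside)))
    by-core (inj₂ (_ , six)) = inj₂ (subst (6 ≤_) (sym (length-enum (InLayer d))) six)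

  gap : ℕ
  gap = n ∸ N + count S

  remaining+gap : length remaining + gap ≡ n
  remaining+gap = begin
    length remaining + (n ∸ N + count S)     ≡⟨ eq (length remaining) (n ∸ N) (count S) ⟩
    n ∸ N + (count S + length remaining)     ≡⟨ cong (n ∸ N +_) core+remaining ⟩
    n ∸ N + N                                ≡⟨ m∸n+n≡m (subst (_≤ n) |V|≡N (count≤ V)) ⟩
    n                                        ∎
    where
    open ≡-Reasoning
    eq : ∀ r d s → r + (d + s) ≡ d + (s + r)
    eq = solve-∀

  weight : Fin N → Fin n → Fin n
  weight v x = nmul G (deg T v) x

  layer-sum : ∀ d A → length (layer d) ≡ length A → lsum (zipWith weight (layer d) A) ≡ nmul G d (lsum A)
  layer-sum d A len =
    trans (cong lsum (constant-weight (layer d) A (All.tabulate (proj₂ ∘ ∈-layer⁻)) len)) (lsum-nmul d A)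
    where
    constant-weight : ∀ vs A → All (λ v → deg T v ≡ d) vs → length vs ≡ length A →
                      zipWith weight vs A ≡ map (nmul G d) A
    constant-weight [] [] _ _ = refl
    constant-weight (v ∷ vs) (x ∷ A) (deg≡d ∷ degs≡d) len =
      cong₂ _∷_ (cong (λ e → nmul G e x) deg≡d) (constant-weight vs A degs≡d (suc-injective len))

  non-core-sum : ∀ ds As → Pointwise ZeroSum (map (length ∘ layer) ds) As →
                 lsum (zipWith weight (non-core ds) (concat As)) ≡ 0g
  non-core-sum [] [] [] = refl
  non-core-sum (d ∷ ds) (A ∷ As) ((A-len , A-sum) ∷ As-zero) = begin
    lsum (zipWith weight (layer d ++ non-core ds) (A ++ concat As))
      ≡⟨ cong lsum (zipWith-++ weight {layer d} {non-core ds} {A} {concat As} (sym A-len)) ⟩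
    lsum (zipWith weight (layer d) A ++ zipWith weight (non-core ds) (concat As))
      ≡⟨ lsum-++ (zipWith weight (layer d) A) _ ⟩
    lsum (zipWith weight (layer d) A) ⊕ lsum (zipWith weight (non-core ds) (concat As))
      ≡⟨ cong₂ _⊕_ (layer-sum d A (sym A-len)) (non-core-sum ds As As-zero) ⟩
    nmul G d (lsum A) ⊕ 0g
      ≡⟨ cong (λ x → nmul G d x ⊕ 0g) A-sum ⟩
    nmul G d 0g ⊕ 0g
      ≡⟨ trans (identityʳ _) (nmul-0g d) ⟩
    0g ∎
    where open ≡-Reasoning

  module Assembly (rest : List (Fin n)) (As : List (List (Fin n))) (remaining↭ : remaining ↭ rest ++ concat As)
                  (rest-zero : ZeroSum (length (layer d*)) rest)
                  (As-zero : Pointwise ZeroSum (map (length ∘ layer) others) As) where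

    values : List (Fin n)
    values = image ++ (rest ++ concat As)

    values↭ : enum V ↭ values
    values↭ = ↭-trans targets↭ (++⁺ˡ image remaining↭)

    length-values : length vertices ≡ length values
    length-values = trans length-vertices (trans (sym |V|≡N) (trans (sym (length-enum V)) (↭-length values↭)))

    open Tabulation (Fin._≟_ {N}) 0g

    h : Fin N → Fin n
    h = lookup-assoc (zip vertices values)

    map-h : map h vertices ≡ values
    map-h = map-lookup-zip Unique-vertices length-values

    h-values : ∀ v → h v ∈ values
    h-values v = subst (h v ∈_) map-h (∈-map⁺ h (∈-vertices v))

    h-injective : ∀ u v → h u ≡ h v → u ≡ v
    h-injective u v = Unique-map⇒injectiveOn (subst Unique (sym map-h) (Unique-resp-↭ values↭ Unique-enum))
                                              (∈-vertices u) (∈-vertices v)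

    h-onto : ∀ g → V g ≡ true → ∃ λ v → h v ≡ g
    h-onto g Vg with ∈-map⁻ h (subst (g ∈_) (sym map-h) (∈-resp-↭ values↭ (∈-enum⁺ Vg)))
    ... | v , _ , g≡hv = v , sym g≡hv

    h-into : ∀ v → V (h v) ≡ true
    h-into v = ∈-enum⁻ (∈-resp-↭ (↭-sym values↭) (h-values v))

    h-extends : ∀ v → S v ≡ true → h v ≡ φ v
    h-extends v Sv = map-cong-local⁻ h≗φ (∈-enum⁺ Sv)
      where
      h≗φ : map h (enum S) ≡ image
      h≗φ = ++-injectiveˡ (trans (length-map h (enum S)) (sym (length-map φ (enum S))))
                          (trans (sym (map-++ h (enum S) _)) map-h)

    h-weighted-sum : gsum G (λ v → weight v (h v)) ≡ setSum G C
    h-weighted-sum = begin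
      gsum G (λ v → weight v (h v))
        ≡⟨ gsum-as-lsum (λ v → weight v (h v)) ⟩
      lsum (map (λ v → weight v (h v)) (allFin N))
        ≡⟨ lsum-↭ (Permutation.map⁺ _ vertices↭) ⟩
      lsum (map (λ v → weight v (h v)) vertices)
        ≡⟨ cong lsum (sym (zipWith-map weight h vertices)) ⟩
      lsum (zipWith weight vertices (map h vertices))
        ≡⟨ cong (lsum ∘ zipWith weight vertices) map-h ⟩
      lsum (zipWith weight vertices values)
        ≡⟨ cong lsum (zipWith-++ weight {enum S} {non-core (d* ∷ others)} {image} {rest ++ concat As}
                                 (sym (length-map φ (enum S)))) ⟩
      lsum (zipWith weight (enum S) image ++ zipWith weight (non-core (d* ∷ others)) (rest ++ concat As))
        ≡⟨ lsum-++ (zipWith weight (enum S) image) _ ⟩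
      lsum (zipWith weight (enum S) image) ⊕ lsum (zipWith weight (non-core (d* ∷ others)) (rest ++ concat As))
        ≡⟨ cong₂ _⊕_ core-part (non-core-sum (d* ∷ others) (rest ∷ As) (rest-zero ∷ As-zero)) ⟩
      setSum G C ⊕ 0g
        ≡⟨ identityʳ _ ⟩
      setSum G C ∎
      where
      open ≡-Reasoning
      core-part : lsum (zipWith weight (enum S) image) ≡ setSum G C
      core-part = trans (cong lsum (zipWith-map weight φ (enum S)))
                        (trans (sym (gsum-if S (λ v → weight v (φ v)))) core-weighted-sum)

    pseudoembedding : ∃ λ h → Pseudo T G V C h × (∀ v → S v ≡ true → h v ≡ φ v)
    pseudoembedding = h , (h-injective , h-onto , h-into , h-weighted-sum) , h-extends

  extends-to-pseudoembedding : suc (suc Δ) * (3 * gap + 36 * suc Δ + 5) + gap ≤ n →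
              ∃ λ h → Pseudo T G V C h × (∀ v → S v ≡ true → h v ≡ φ v)
  extends-to-pseudoembedding wide =
    let (rest , As , remaining↭ , rest-zero , As-zero) =
          zero-sum-partition remaining Unique-enum remaining-sum (suc Δ) gap (length (layer d*))
            (map (length ∘ layer) others) admissible largest few length-remaining remaining+gap dense
    in Assembly.pseudoembedding rest As remaining↭ rest-zero As-zero
    where
    in-range : ∀ {d} → d ∈ others → d ≤ Δ
    in-range d∈ = ≤-pred (∈-upTo⁻ (proj₁ (∈-filter⁻ (λ d → ¬? (d ℕ.≟ d*)) {xs = upTo (suc Δ)} d∈)))
    admissible : All Admissible (map (length ∘ layer) others)
    admissible = All.map⁺ (All.tabulate (λ {d} d∈ → layer-admissible d (in-range d∈)))
    largest : All (_≤ length (layer d*)) (map (length ∘ layer) others)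
    largest = All.map⁺ (All.filter⁺ (λ d → ¬? (d ℕ.≟ d*)) d*-largest)
    few : length (map (length ∘ layer) others) ≤ suc Δ
    few = ≤-trans (≤-reflexive (length-map _ others))
                  (≤-trans (length-filter (λ d → ¬? (d ℕ.≟ d*)) (upTo (suc Δ))) (≤-reflexive (length-upTo (suc Δ))))
    dense : suc (suc Δ) * (3 * gap + 36 * suc Δ + 5) ≤ length remaining
    dense = +-cancelʳ-≤ gap (suc (suc Δ) * (3 * gap + 36 * suc Δ + 5)) (length remaining)
              (subst (suc (suc Δ) * (3 * gap + 36 * suc Δ + 5) + gap ≤_) (sym remaining+gap) wide)

-- Choosing n₀

^-distribʳ-* : ∀ m n o → (m * n) ^ o ≡ m ^ o * n ^ o
^-distribʳ-* m n zero = refl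
^-distribʳ-* m n (suc o) = trans (cong (m * n *_) (^-distribʳ-* m n o)) (rearrange m n (m ^ o) (n ^ o))
  where
  rearrange : ∀ m n a b → m * n * (a * b) ≡ m * a * (n * b)
  rearrange = solve-∀

m≤m^n : ∀ m {n} .{{_ : ℕ.NonZero m}} → 0 < n → m ≤ m ^ n
m≤m^n m {suc n} _ = m≤m*n m (m ^ n) {{m^n≢0 m n}}

small-from-power-bound : ∀ {K n x p q} → 0 < p → K ^ q < n → x ^ q * n ^ p ≤ n ^ q → K * x < n
small-from-power-bound {K} {suc n′} {x} {p} {q} p>0 Kq<n bound with suc n′ ≤? K * x
... | no n≰Kx = ≰⇒> n≰Kx
... | yes n≤Kx = contradiction (≤-trans (m≤m^n n p>0) (n^p≤K^q x n≤Kx bound)) (<⇒≱ Kq<n)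
  where
  n : ℕ
  n = suc n′
  n^p≤K^q : ∀ x → n ≤ K * x → x ^ q * n ^ p ≤ n ^ q → n ^ p ≤ K ^ q
  n^p≤K^q zero n≤0 _ = contradiction (≤-trans n≤0 (≤-reflexive (*-zeroʳ K))) λ ()
  n^p≤K^q x@(suc _) n≤Kx bound = *-cancelˡ-≤ (x ^ q) {{m^n≢0 x q}} (begin
    x ^ q * n ^ p         ≤⟨ bound ⟩
    n ^ q                 ≤⟨ ^-monoˡ-≤ q n≤Kx ⟩
    (K * x) ^ q           ≡⟨ ^-distribʳ-* K x q ⟩
    K ^ q * x ^ q         ≡⟨ *-comm (K ^ q) (x ^ q) ⟩
    x ^ q * K ^ q         ∎)
    where open ≤-Reasoning

wide-from-small : ∀ D x₁ x₂ n → 4 * (3 * D + 4) * x₁ < n → 4 * (3 * D + 4) * x₂ < n →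
                  2 * (suc D * (36 * D + 5)) ≤ n → suc D * (3 * (x₁ + x₂) + 36 * D + 5) + (x₁ + x₂) ≤ n
wide-from-small D x₁ x₂ n x₁-small x₂-small n-large = *-cancelˡ-≤ 4 (begin
  4 * (suc D * (3 * (x₁ + x₂) + 36 * D + 5) + (x₁ + x₂))
    ≡⟨ eq D x₁ x₂ ⟩
  4 * (3 * D + 4) * x₁ + 4 * (3 * D + 4) * x₂ + 2 * (2 * (suc D * (36 * D + 5)))
    ≤⟨ +-mono-≤ (+-mono-≤ (<⇒≤ x₁-small) (<⇒≤ x₂-small)) (*-monoʳ-≤ 2 n-large) ⟩
  n + n + 2 * n
    ≡⟨ eq′ n ⟩
  4 * n ∎)
  where
  open ≤-Reasoning
  eq : ∀ D x₁ x₂ → 4 * (suc D * (3 * (x₁ + x₂) + 36 * D + 5) + (x₁ + x₂))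
                 ≡ 4 * (3 * D + 4) * x₁ + 4 * (3 * D + 4) * x₂ + 2 * (2 * (suc D * (36 * D + 5)))
  eq = solve-∀
  eq′ : ∀ n → n + n + 2 * n ≡ 4 * n
  eq′ = solve-∀

-- The argument works for every α > 0, so α₀ = 1.
lemma4p6 : ∀ (Δ : ℕ) → 1 ≤ Δ →
    ∃ λ p₀ → ∃ λ q₀ → 0 < p₀ × 0 < q₀ ×
    (∀ p q → 0 < p → 0 < q → p * q₀ ≤ p₀ * q →
      ∃ λ n₀ → ∀ n → n₀ ≤ n →
      (G : FinAbGroup n) → (N : ℕ) → (T : Tree N) → MaxDeg T Δ →
      (V C : Fin n → Bool) → count V ≡ N → suc (count C) ≡ N →
      (n ∸ N) ^ q * n ^ p ≤ n ^ q →
      (IsZ2Power G → C (FinAbGroup.0g G) ≡ false) →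
      (S : Fin N → Bool) → IsCore T Δ S → count S ^ q * n ^ p ≤ n ^ q →
      (φ : Fin N → Fin n) → RainbowOn T G S V C φ →
      gsum G (λ v → if-in S v (nmul G (deg T v) (φ v)) G) ≡ setSum G C →
      gsum G (λ v → if-in S v (φ v) G) ≡ setSum G V →
      ∃ λ h → Pseudo T G V C h × (∀ v → S v ≡ true → h v ≡ φ v))
lemma4p6 Δ _ = 1 , 1 , s≤s z≤n , s≤s z≤n , λ p q p>0 _ _ →
  suc (K ^ q + X) , λ n n₀≤n G N T (bounded , _) V C |V|≡N _ gap-small _ S core core-small φ rainbow weighted-sum core-sum →
    Extension.extends-to-pseudoembedding G T Δ V C S φ bounded |V|≡N core (proj₁ rainbow) (proj₁ (proj₂ rainbow))
      weighted-sum core-sum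
      (wide-from-small (suc Δ) (n ∸ N) (count S) n
        (small-from-power-bound {K} {n} {n ∸ N} {p} {q} p>0 (≤-trans (s≤s (m≤m+n (K ^ q) X)) n₀≤n) gap-small)
        (small-from-power-bound {K} {n} {count S} {p} {q} p>0 (≤-trans (s≤s (m≤m+n (K ^ q) X)) n₀≤n) core-small)
        (≤-trans (m≤n+m X (K ^ q)) (≤-trans (n≤1+n _) n₀≤n)))
  where
  K X : ℕ
  K = 4 * (3 * suc Δ + 4)
  X = 2 * (suc (suc Δ) * (36 * suc Δ + 5))
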